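{- Let $H=T\cup C_n$ be a Halin graph whose outer cycle $C_n$ has odd length $n$, and suppose $H$ is not a wheel. Then $AT(H)=3$.
   Context: All graphs are finite and simple. A Halin graph $H=T\cup C_n$ is a plane graph where $T$ is a plane tree with no vertex of degree two and at least one vertex of degree at least three, and $C_n$ (the outer cycle) is a cycle through all the leaves of $T$, connecting them in the cyclic order determined by the planar drawing of $T$. Vertices not on $C_n$ are inner vertices; a wheel is a Halin graph with exactly one inner vertex. For a digraph $D$, an Eulerian subdigraph is a spanning subdigraph (possibly disconnected, possibly with no arcs) in which every vertex has indegree equal to outdegree; it is even or odd according to the parity of its number of arcs. $D$ is Alon-Tarsi if the number of even Eulerian subdigraphs of $D$ differs from the number of odd ones. The Alon-Tarsi number $AT(G)$ of a graph $G$ is the smallest integer $k$ such that $G$ has an orientation which is Alon-Tarsi and has maximum outdegree at most $k-1$. -}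

module Defs where

open import Data.Nat using (ℕ; zero; suc; _+_; _<_; _≤_; _≡ᵇ_; _%_)
open import Data.Bool using (Bool; true; false; _∧_; if_then_else_; not)
open import Data.List using (List; []; _∷_; _++_; [_]; length; map; filterᵇ; upTo; foldr)
open import Data.List.Relation.Unary.All using (All)
open import Data.List.Relation.Unary.Any using (Any)
open import Data.Vec using (Vec; toList)
open import Data.Product using (_×_; _,_; Σ; proj₁; proj₂)
open import Relation.Binary.PropositionalEquality using (_≡_; _≢_)
open import Relation.Nullary using (¬_)

-- Finite simple graphs: vertices 0 .. nV-1, edge list of unordered pairs
-- (each edge listed once, in some direction).

record Graph : Set where
  constructor mkGraph
  field
    nV    : ℕ
    edges : List (ℕ × ℕ)
open Graph public

outdeg : ℕ → List (ℕ × ℕ) → ℕ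
outdeg v arcs = length (filterᵇ (λ a → proj₁ a ≡ᵇ v) arcs)

indeg : ℕ → List (ℕ × ℕ) → ℕ
indeg v arcs = length (filterᵇ (λ a → proj₂ a ≡ᵇ v) arcs)

orient : List (ℕ × ℕ) → List Bool → List (ℕ × ℕ)
orient [] _ = []
orient (_ ∷ _) [] = []
orient ((u , v) ∷ es) (true ∷ bs) = (u , v) ∷ orient es bs
orient ((u , v) ∷ es) (false ∷ bs) = (v , u) ∷ orient es bs

select : List (ℕ × ℕ) → List Bool → List (ℕ × ℕ)
select [] _ = []
select (_ ∷ _) [] = []
select (a ∷ as) (true ∷ bs) = a ∷ select as bs
select (a ∷ as) (false ∷ bs) = select as bs

masks : ℕ → List (List Bool)
masks zero = [ [] ]
masks (suc m) = map (true ∷_) (masks m) ++ map (false ∷_) (masks m)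

isEulerian : ℕ → List (ℕ × ℕ) → Bool
isEulerian nV arcs = foldr (λ b r → b ∧ r) true (map (λ v → indeg v arcs ≡ᵇ outdeg v arcs) (upTo nV))

isEven : ℕ → Bool
isEven n = n % 2 ≡ᵇ 0

evenEulerian : ℕ → List (ℕ × ℕ) → ℕ
evenEulerian nV arcs =
  length (filterᵇ (λ s → isEulerian nV (select arcs s) ∧ isEven (length (select arcs s)))
                  (masks (length arcs)))

oddEulerian : ℕ → List (ℕ × ℕ) → ℕ
oddEulerian nV arcs =
  length (filterᵇ (λ s → isEulerian nV (select arcs s) ∧ not (isEven (length (select arcs s))))
                  (masks (length arcs)))

AlonTarsi : ℕ → List (ℕ × ℕ) → Set
AlonTarsi nV arcs = evenEulerian nV arcs ≢ oddEulerian nV arcs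

HasATOrientation : Graph → ℕ → Set
HasATOrientation G k =
  Σ (Vec Bool (length (edges G))) λ o →
    ((v : ℕ) → v < nV G → outdeg v (orient (edges G) (toList o)) < k)
    × AlonTarsi (nV G) (orient (edges G) (toList o))

ATNumber : Graph → ℕ → Set
ATNumber G k = HasATOrientation G k × ((j : ℕ) → j < k → ¬ HasATOrientation G j)

-- Plane trees, encoded as ordered (planar) rooted trees: the children of
-- each node are listed in the clockwise order of the drawing.

data Tree : Set where
  node : List Tree → Tree

IsLeaf : Tree → Set
IsLeaf (node ts) = ts ≡ []

-- no non-root vertex has degree two: no node has exactly one child
mutual
  NoDeg2 : Tree → Set
  NoDeg2 (node ts) = length ts ≢ 1 × NoDeg2F ts

  NoDeg2F : List Tree → Set
  NoDeg2F [] = Data.Unit.⊤ where import Data.Unit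
  NoDeg2F (t ∷ ts) = NoDeg2 t × NoDeg2F ts

-- a plane tree with no vertex of degree 2 and (rooted at) a vertex of degree ≥ 3
HalinTree : Tree → Set
HalinTree (node ts) = 3 ≤ length ts × NoDeg2F ts

-- the rooted tree has more than one inner vertex (some child of the root is inner)
NotWheel : Tree → Set
NotWheel (node ts) = Any (λ t → ¬ IsLeaf t) ts

-- Preorder labelling: label t s numbers the nodes of t by s, s+1, ...,
-- returning (next free label, tree edges, leaves in left-to-right order).
mutual
  label : Tree → ℕ → ℕ × List (ℕ × ℕ) × List ℕ
  label (node []) s = suc s , [] , [ s ]
  label (node (c ∷ cs)) s = labelF (c ∷ cs) s (suc s)

  labelF : List Tree → ℕ → ℕ → ℕ × List (ℕ × ℕ) × List ℕ
  labelF [] p n = n , [] , []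
  labelF (t ∷ ts) p n with label t n
  ... | n₁ , e₁ , l₁ with labelF ts p n₁
  ... | n₂ , e₂ , l₂ = n₂ , ((p , n) ∷ e₁ ++ e₂) , l₁ ++ l₂

cycleEdges : List ℕ → List (ℕ × ℕ)
cycleEdges [] = []
cycleEdges (x ∷ xs) = go x xs
  where
  go : ℕ → List ℕ → List (ℕ × ℕ)
  go y [] = [ (y , x) ]
  go y (z ∷ zs) = (y , z) ∷ go z zs

leaves : Tree → List ℕ
leaves t = proj₂ (proj₂ (label t 0))

outerLength : Tree → ℕ
outerLength t = length (leaves t)

halin : Tree → Graph
halin t = mkGraph (proj₁ (label t 0))
                  (proj₁ (proj₂ (label t 0)) ++ cycleEdges (leaves t))

-- AT(H) ≥ 3: H has |V| − 1 + n > |V| edges, so every orientation has a vertex of outdegree at least 2.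
--
-- AT(H) ≤ 3: take an inner vertex P all of whose children are leaves P+1, …, P+k. Such a P with k ≥ 2
-- exists because no vertex has degree 2, and there are at least two further leaves because H is not a
-- wheel. Turn the tree edges towards the root, except P → P+1, and cut the outer cycle at P+1 and a leaf
-- y into two directed paths from P+1 to y: one along P+1, …, P+m, the other through all remaining leaves;
-- for k odd take m = k and y the leaf after P+k, for k even take m = k − 1 and y = P+k. Every outdegree is
-- then at most 2. The number of even minus odd Eulerian subdigraphs is a signed sum over arc subsets
-- balancing a demand vector; in it, arcs into vertices that no later arc leaves can be dropped, and a
-- zero-demand inner vertex of a path forces the path to be taken whole. What remains is the fan at P with
-- the two paths, and the choice of m makes its signed sum 1.

module Submission where

open import Defs
open import Data.Nat using (_%_)
open import Relation.Binary.PropositionalEquality using (_≡_)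
open import Data.List using ([]; _∷_)
open import Data.Product using (_,_)

module EulerSum where

  open import Data.Nat as ℕ using (ℕ; zero; suc; _≟_)
  open import Data.Integer as ℤ using (ℤ; +_; _+_; _-_; -_; _*_; _^_; 0ℤ; 1ℤ; -1ℤ)
  import Data.Integer.Properties as ℤP
  open import Data.Integer.Solver using (module +-*-Solver)
  open +-*-Solver using (solve; _:+_; _:-_; _:*_; _:=_; con)
  open import Data.Bool using (Bool; true; false; T; if_then_else_)
  open import Data.List using (List; []; _∷_; _++_; [_]; length; upTo)
  open import Data.Bool.ListAction using (and; all)
  open import Data.List.Membership.Propositional.Properties using (∈-upTo⁺)
  open import Data.List.Relation.Unary.All as All using (All; []; _∷_)
  import Data.List.Relation.Unary.All.Properties as AllP
  open import Data.List.Relation.Unary.AllPairs using (AllPairs; []; _∷_)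
  open import Data.List.Relation.Binary.Permutation.Propositional as ↭ using (_↭_)
  import Data.List.Properties as LP
  open import Data.Product using (_×_; _,_; proj₁; proj₂)
  open import Data.Empty using (⊥-elim)
  open import Relation.Nullary using (does)
  open import Relation.Nullary.Decidable using (dec-true; dec-false)
  open import Relation.Binary.PropositionalEquality hiding ([_])

  Arc : Set
  Arc = ℕ × ℕ

  -- a demand δ prescribes, at each vertex, the surplus indegree − outdegree still to be
  -- added; an arc set S is admissible when δ + indeg_S − outdeg_S vanishes on 0 … N−1
  Demand : Set
  Demand = ℕ → ℤ

  indicator : ℕ → ℕ → ℤ
  indicator x v = if does (x ≟ v) then 1ℤ else 0ℤ

  _⊕_ : Demand → Arc → Demand
  (δ ⊕ a) v = δ v + indicator (proj₂ a) v - indicator (proj₁ a) v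

  isZero : ℤ → Bool
  isZero (+ zero) = true
  isZero _        = false

  vanishesBelow : ℕ → Demand → Bool
  vanishesBelow N δ = all (λ v → isZero (δ v)) (upTo N)

  -- eulerSum N δ A = ∑_{S ⊆ A} (−1)^|S| [S is admissible for δ]
  eulerSum : ℕ → Demand → List Arc → ℤ
  eulerSum N δ []      = if vanishesBelow N δ then 1ℤ else 0ℤ
  eulerSum N δ (a ∷ A) = eulerSum N δ A - eulerSum N (δ ⊕ a) A

  zeroDemand : Demand
  zeroDemand _ = 0ℤ

  vanishesBelow-cong : ∀ N {δ δ′} → δ ≗ δ′ → vanishesBelow N δ ≡ vanishesBelow N δ′
  vanishesBelow-cong N δ≗δ′ = cong and (LP.map-cong (λ v → cong isZero (δ≗δ′ v)) (upTo N))

  ⊕-cong : ∀ {δ δ′} a → δ ≗ δ′ → δ ⊕ a ≗ δ′ ⊕ a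
  ⊕-cong a δ≗δ′ v = cong (λ z → z + indicator (proj₂ a) v - indicator (proj₁ a) v) (δ≗δ′ v)

  eulerSum-cong : ∀ N {δ δ′} A → δ ≗ δ′ → eulerSum N δ A ≡ eulerSum N δ′ A
  eulerSum-cong N []      δ≗δ′ = cong (if_then 1ℤ else 0ℤ) (vanishesBelow-cong N δ≗δ′)
  eulerSum-cong N (a ∷ A) δ≗δ′ = cong₂ _-_ (eulerSum-cong N A δ≗δ′) (eulerSum-cong N A (⊕-cong a δ≗δ′))

  ⊕-comm : ∀ δ a b → (δ ⊕ a) ⊕ b ≗ (δ ⊕ b) ⊕ a
  ⊕-comm δ a b v = solve 5 (λ d x y z w → d :+ x :- y :+ z :- w := d :+ z :- w :+ x :- y) refl
    (δ v) (indicator (proj₂ a) v) (indicator (proj₁ a) v) (indicator (proj₂ b) v) (indicator (proj₁ b) v)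

  eulerSum-↭ : ∀ N δ {A B} → A ↭ B → eulerSum N δ A ≡ eulerSum N δ B
  eulerSum-↭ N δ ↭.refl        = refl
  eulerSum-↭ N δ (↭.prep a p)  = cong₂ _-_ (eulerSum-↭ N δ p) (eulerSum-↭ N (δ ⊕ a) p)
  eulerSum-↭ N δ (↭.trans p q) = trans (eulerSum-↭ N δ p) (eulerSum-↭ N δ q)
  eulerSum-↭ N δ (↭.swap {ys = B} a b p) =
    trans (cong₂ _-_ (cong₂ _-_ (eulerSum-↭ N δ p) (eulerSum-↭ N (δ ⊕ b) p))
                     (cong₂ _-_ (eulerSum-↭ N (δ ⊕ a) p)
                                (trans (eulerSum-↭ N ((δ ⊕ a) ⊕ b) p) (eulerSum-cong N B (⊕-comm δ a b)))))
          (exchange (eulerSum N δ B) (eulerSum N (δ ⊕ b) B) (eulerSum N (δ ⊕ a) B) (eulerSum N ((δ ⊕ b) ⊕ a) B))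
    where
    exchange : ∀ p q r s → p - q - (r - s) ≡ p - r - (q - s)
    exchange = solve 4 (λ p q r s → p :- q :- (r :- s) := p :- r :- (q :- s)) refl

  indicator-refl : ∀ v → indicator v v ≡ 1ℤ
  indicator-refl v rewrite dec-true (v ≟ v) refl = refl

  indicator-≢ : ∀ {x v} → x ≢ v → indicator x v ≡ 0ℤ
  indicator-≢ {x} {v} x≢v rewrite dec-false (x ≟ v) x≢v = refl

  ⊕-head : ∀ δ {x y} → x ≢ y → (δ ⊕ (x , y)) y ≡ δ y + 1ℤ
  ⊕-head δ {x} {y} x≢y rewrite indicator-refl y | indicator-≢ x≢y = ℤP.+-identityʳ _

  ⊕-tail : ∀ δ {x y} → x ≢ y → (δ ⊕ (x , y)) x ≡ δ x - 1ℤ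
  ⊕-tail δ {x} {y} x≢y rewrite indicator-refl x | indicator-≢ (≢-sym x≢y) =
    cong (_- 1ℤ) (ℤP.+-identityʳ (δ x))

  ⊕-elsewhere : ∀ δ {x y v} → x ≢ v → y ≢ v → (δ ⊕ (x , y)) v ≡ δ v
  ⊕-elsewhere δ {v = v} x≢v y≢v rewrite indicator-≢ x≢v | indicator-≢ y≢v =
    trans (ℤP.+-identityʳ _) (ℤP.+-identityʳ _)

  ⊕-tailFree : ∀ δ a v → proj₁ a ≢ v → δ v ℤ.≤ (δ ⊕ a) v
  ⊕-tailFree δ (x , y) v x≢v rewrite indicator-≢ x≢v with does (y ≟ v)
  ... | true  = ℤP.≤-trans (ℤP.i≤i+j (δ v) 1ℤ) (ℤP.≤-reflexive (sym (ℤP.+-identityʳ _)))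
  ... | false = ℤP.≤-reflexive (sym (trans (ℤP.+-identityʳ _) (ℤP.+-identityʳ _)))

  ⊕-headFree : ∀ δ a v → proj₂ a ≢ v → (δ ⊕ a) v ℤ.≤ δ v
  ⊕-headFree δ (x , y) v y≢v rewrite indicator-≢ y≢v with does (x ≟ v)
  ... | true  = ℤP.i≤j⇒i-k≤j 1ℤ (ℤP.≤-reflexive (ℤP.+-identityʳ (δ v)))
  ... | false = ℤP.≤-reflexive (trans (ℤP.+-identityʳ _) (ℤP.+-identityʳ _))

  ⊕-head-positive : ∀ δ {x y} → x ≢ y → 0ℤ ℤ.≤ δ y → 0ℤ ℤ.< (δ ⊕ (x , y)) y
  ⊕-head-positive δ x≢y 0≤δy =
    subst (0ℤ ℤ.<_) (sym (⊕-head δ x≢y)) (ℤP.<-≤-trans (ℤ.+<+ ℕ.z<s) (ℤP.+-monoˡ-≤ 1ℤ 0≤δy))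

  ⊕-tail-negative : ∀ δ {x y} → x ≢ y → δ x ℤ.≤ 0ℤ → (δ ⊕ (x , y)) x ℤ.< 0ℤ
  ⊕-tail-negative δ x≢y δx≤0 =
    subst (ℤ._< 0ℤ) (sym (⊕-tail δ x≢y)) (ℤP.≤-<-trans (ℤP.+-monoˡ-≤ -1ℤ δx≤0) ℤ.-<+)

  isZero⇒≡0 : ∀ z → T (isZero z) → z ≡ 0ℤ
  isZero⇒≡0 (+ zero) _ = refl

  eulerSum-[]-nonvanishing : ∀ {N δ v} → v ℕ.< N → δ v ≢ 0ℤ → eulerSum N δ [] ≡ 0ℤ
  eulerSum-[]-nonvanishing {N} {δ} {v} v<N δv≢0 with vanishesBelow N δ in eq
  ... | false = refl
  ... | true  = ⊥-elim (δv≢0 (isZero⇒≡0 (δ v)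
                  (All.lookup (AllP.all⁺ _ (upTo N) (subst T (sym eq) _)) (∈-upTo⁺ v<N))))

  eulerSum-zeroDemand-[] : ∀ N → eulerSum N zeroDemand [] ≡ 1ℤ
  eulerSum-zeroDemand-[] N
    with vanishesBelow N zeroDemand | AllP.all⁻ (λ v → isZero (zeroDemand v)) (All.universal _ (upTo N))
  ... | true | _ = refl

  -- the arcs of A can only raise the demand at v, so no subset of A balances it
  eulerSum-positiveSink : ∀ {N δ v} A → v ℕ.< N → 0ℤ ℤ.< δ v → All (λ a → proj₁ a ≢ v) A →
                          eulerSum N δ A ≡ 0ℤ
  eulerSum-positiveSink [] v<N 0<δv _ = eulerSum-[]-nonvanishing v<N (≢-sym (ℤP.<⇒≢ 0<δv))
  eulerSum-positiveSink {δ = δ} {v} (a ∷ A) v<N 0<δv (a↛v ∷ A↛v) =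
    cong₂ _-_ (eulerSum-positiveSink A v<N 0<δv A↛v)
              (eulerSum-positiveSink A v<N (ℤP.<-≤-trans 0<δv (⊕-tailFree δ a v a↛v)) A↛v)

  eulerSum-negativeSource : ∀ {N δ v} A → v ℕ.< N → δ v ℤ.< 0ℤ → All (λ a → proj₂ a ≢ v) A →
                            eulerSum N δ A ≡ 0ℤ
  eulerSum-negativeSource [] v<N δv<0 _ = eulerSum-[]-nonvanishing v<N (ℤP.<⇒≢ δv<0)
  eulerSum-negativeSource {δ = δ} {v} (a ∷ A) v<N δv<0 (v↛a ∷ v↛A) =
    cong₂ _-_ (eulerSum-negativeSource A v<N δv<0 v↛A)
              (eulerSum-negativeSource A v<N (ℤP.≤-<-trans (⊕-headFree δ a v v↛a) δv<0) v↛A)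

  eulerSum-⊕-noReturn : ∀ {N} δ {x y} A → x ℕ.< N → δ x ≡ 0ℤ → x ≢ y → All (λ a → proj₂ a ≢ x) A →
                        eulerSum N (δ ⊕ (x , y)) A ≡ 0ℤ
  eulerSum-⊕-noReturn δ A x<N δx≡0 x≢y A↛x =
    eulerSum-negativeSource A x<N (⊕-tail-negative δ x≢y (ℤP.≤-reflexive δx≡0)) A↛x

  eulerSum-⊕-noExit : ∀ {N} δ {x y} A → y ℕ.< N → δ y ≡ 0ℤ → x ≢ y → All (λ a → proj₁ a ≢ y) A →
                      eulerSum N (δ ⊕ (x , y)) A ≡ 0ℤ
  eulerSum-⊕-noExit δ A y<N δy≡0 x≢y y↛A =
    eulerSum-positiveSink A y<N (⊕-head-positive δ x≢y (ℤP.≤-reflexive (sym δy≡0))) y↛A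

  eulerSum-dropArcIntoSink : ∀ {N δ} a A → proj₂ a ℕ.< N → 0ℤ ℤ.≤ δ (proj₂ a) → proj₁ a ≢ proj₂ a →
                             All (λ b → proj₁ b ≢ proj₂ a) A → eulerSum N δ (a ∷ A) ≡ eulerSum N δ A
  eulerSum-dropArcIntoSink {N} {δ} (x , y) A y<N 0≤δy x≢y A↛y =
    trans (cong (λ z → eulerSum N δ A - z) (eulerSum-positiveSink A y<N (⊕-head-positive δ x≢y 0≤δy) A↛y))
          (ℤP.+-identityʳ _)

  SinkArcs : ℕ → Demand → List Arc → List Arc → Set
  SinkArcs N δ D R =
    All (λ a → proj₂ a ℕ.< N × 0ℤ ℤ.≤ δ (proj₂ a) × proj₁ a ≢ proj₂ a × All (λ b → proj₁ b ≢ proj₂ a) R) D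
    ×
    AllPairs (λ a b → proj₁ b ≢ proj₂ a) D

  eulerSum-dropSinkArcs : ∀ {N δ} D R → SinkArcs N δ D R → eulerSum N δ (D ++ R) ≡ eulerSum N δ R
  eulerSum-dropSinkArcs []      R _ = refl
  eulerSum-dropSinkArcs (a ∷ D) R ((y<N , 0≤δy , x≢y , R↛y) ∷ sinks , D↛y ∷ later) =
    trans (eulerSum-dropArcIntoSink a (D ++ R) y<N 0≤δy x≢y (AllP.++⁺ D↛y R↛y))
          (eulerSum-dropSinkArcs D R (sinks , later))

  path : List ℕ → List Arc
  path []           = []
  path (x ∷ [])     = []
  path (x ∷ y ∷ zs) = (x , y) ∷ path (y ∷ zs)

  Avoids : ℕ → List Arc → Set
  Avoids w R = All (λ a → proj₁ a ≢ w × proj₂ a ≢ w) R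

  Interior : ℕ → Demand → List Arc → ℕ → ℕ → ℕ → Set
  Interior N δ R x y w = w ℕ.< N × δ w ≡ 0ℤ × Avoids w R × w ≢ x × w ≢ y

  -- balance at a zero-demand interior vertex forces its two path arcs in or out together
  eulerSum-path : ∀ N δ R x y ws → All (Interior N δ R x y) ws → AllPairs _≢_ ws →
    eulerSum N δ (path (x ∷ ws ++ [ y ]) ++ R) ≡
    eulerSum N δ R + -1ℤ ^ suc (length ws) * eulerSum N (δ ⊕ (x , y)) R
  eulerSum-path N δ R x y [] _ _ =
    solve 2 (λ p q → p :- q := p :+ con -1ℤ :* q) refl (eulerSum N δ R) (eulerSum N (δ ⊕ (x , y)) R)
  eulerSum-path N δ R x y (w ∷ ws) ((w<N , δw≡0 , w∉R , w≢x , w≢y) ∷ interior) (w∉ws ∷ distinct) =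
    begin
      eulerSum N δ P - eulerSum N δ′ P
    ≡⟨ cong₂ _-_ (eulerSum-path N δ R w y ws interiorᵃ distinct)
                 (eulerSum-path N δ′ R w y ws interiorᵇ distinct) ⟩
      (eulerSum N δ R + s * eulerSum N (δ ⊕ (w , y)) R) - (eulerSum N δ′ R + s * eulerSum N (δ′ ⊕ (w , y)) R)
    ≡⟨ cong₂ (λ p q → (eulerSum N δ R + s * p) - (q + s * eulerSum N (δ′ ⊕ (w , y)) R)) noBalanceᵃ noBalanceᵇ ⟩
      (eulerSum N δ R + s * 0ℤ) - (0ℤ + s * eulerSum N (δ′ ⊕ (w , y)) R)
    ≡⟨ cong (λ p → (eulerSum N δ R + s * 0ℤ) - (0ℤ + s * p)) (eulerSum-cong N R shortcut) ⟩
      (eulerSum N δ R + s * 0ℤ) - (0ℤ + s * eulerSum N (δ ⊕ (x , y)) R)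
    ≡⟨ solve 3 (λ p s q → (p :+ s :* con 0ℤ) :- (con 0ℤ :+ s :* q) := p :+ (con -1ℤ :* s) :* q) refl
               (eulerSum N δ R) s (eulerSum N (δ ⊕ (x , y)) R) ⟩
      eulerSum N δ R + -1ℤ ^ suc (length (w ∷ ws)) * eulerSum N (δ ⊕ (x , y)) R
    ∎
    where
    open ≡-Reasoning
    P : List Arc
    P = path (w ∷ ws ++ [ y ]) ++ R
    δ′ : Demand
    δ′ = δ ⊕ (x , w)
    s : ℤ
    s = -1ℤ ^ suc (length ws)
    noBalanceᵃ : eulerSum N (δ ⊕ (w , y)) R ≡ 0ℤ
    noBalanceᵃ = eulerSum-⊕-noReturn δ R w<N δw≡0 w≢y (All.map proj₂ w∉R)
    noBalanceᵇ : eulerSum N δ′ R ≡ 0ℤ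
    noBalanceᵇ = eulerSum-⊕-noExit δ R w<N δw≡0 (≢-sym w≢x) (All.map proj₁ w∉R)
    interiorᵃ : All (Interior N δ R w y) ws
    interiorᵃ = All.zipWith (λ { ((v<N , δv , v∉R , _ , v≢y) , w≢v) → v<N , δv , v∉R , ≢-sym w≢v , v≢y })
                            (interior , w∉ws)
    interiorᵇ : All (Interior N δ′ R w y) ws
    interiorᵇ = All.zipWith
      (λ { ((v<N , δv , v∉R , v≢x , v≢y) , w≢v) →
           v<N , trans (⊕-elsewhere δ (≢-sym v≢x) w≢v) δv , v∉R , ≢-sym w≢v , v≢y })
      (interior , w∉ws)
    shortcut : δ′ ⊕ (w , y) ≗ δ ⊕ (x , y)
    shortcut v = solve 4 (λ d a b c → d :+ a :- b :+ c :- a := d :+ c :- b) refl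
      (δ v) (indicator w v) (indicator x v) (indicator y v)

module EulerianCount where

  open EulerSum
  open import Data.Nat as ℕ using (ℕ; zero; suc; _≡ᵇ_)
  open import Data.Integer as ℤ using (ℤ; +_; _+_; _-_; -_; _^_; 0ℤ; 1ℤ; -1ℤ; _⊖_)
  import Data.Integer.Properties as ℤP
  open import Data.Integer.Solver using (module +-*-Solver)
  open +-*-Solver using (solve; _:+_; _:-_; _:=_)
  open import Data.Bool using (Bool; true; false; not; _∧_; if_then_else_)
  open import Data.Bool.ListAction using (and)
  open import Data.List using (List; []; _∷_; _++_; length; map; filterᵇ; upTo)
  import Data.List.Properties as LP
  open import Data.Product using (proj₁; proj₂)
  open import Relation.Binary.PropositionalEquality

  balance : List Arc → Demand
  balance X v = + indeg v X - + outdeg v X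

  ≡ᵇ≡isZero⊖ : ∀ a b → (a ≡ᵇ b) ≡ isZero (a ⊖ b)
  ≡ᵇ≡isZero⊖ zero    zero    = refl
  ≡ᵇ≡isZero⊖ zero    (suc b) = refl
  ≡ᵇ≡isZero⊖ (suc a) zero    = refl
  ≡ᵇ≡isZero⊖ (suc a) (suc b) = trans (≡ᵇ≡isZero⊖ a b) (cong isZero (sym (ℤP.[1+m]⊖[1+n]≡m⊖n a b)))

  isEulerian≡vanishesBelow : ∀ N X → isEulerian N X ≡ vanishesBelow N (balance X)
  isEulerian≡vanishesBelow N X = cong and (LP.map-cong balanced (upTo N))
    where
    balanced : ∀ v → (indeg v X ≡ᵇ outdeg v X) ≡ isZero (balance X v)
    balanced v = trans (≡ᵇ≡isZero⊖ (indeg v X) (outdeg v X))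
                       (cong isZero (sym (ℤP.m-n≡m⊖n (indeg v X) (outdeg v X))))

  count-∷ : ∀ {A : Set} (p : A → Bool) x xs →
            + length (filterᵇ p (x ∷ xs)) ≡ (if p x then 1ℤ else 0ℤ) + + length (filterᵇ p xs)
  count-∷ p x xs with p x
  ... | true  = refl
  ... | false = sym (ℤP.+-identityˡ _)

  balance-∷ : ∀ a X v → balance (a ∷ X) v ≡ balance X v + indicator (proj₂ a) v - indicator (proj₁ a) v
  balance-∷ a X v =
    trans (cong₂ _-_ (count-∷ (λ b → proj₂ b ≡ᵇ v) a X) (count-∷ (λ b → proj₁ b ≡ᵇ v) a X))
          (solve 4 (λ h i t o → h :+ i :- (t :+ o) := i :- o :+ h :- t) refl
                 (indicator (proj₂ a) v) (+ indeg v X) (indicator (proj₁ a) v) (+ outdeg v X))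

  ∑ : {A : Set} → List A → (A → ℤ) → ℤ
  ∑ []       f = 0ℤ
  ∑ (x ∷ xs) f = f x + ∑ xs f

  ∑-++ : ∀ {A : Set} (xs ys : List A) f → ∑ (xs ++ ys) f ≡ ∑ xs f + ∑ ys f
  ∑-++ []       ys f = sym (ℤP.+-identityˡ _)
  ∑-++ (x ∷ xs) ys f = trans (cong (λ z → f x + z) (∑-++ xs ys f)) (sym (ℤP.+-assoc (f x) _ _))

  ∑-map : ∀ {A B : Set} (g : A → B) xs f → ∑ (map g xs) f ≡ ∑ xs (λ x → f (g x))
  ∑-map g []       f = refl
  ∑-map g (x ∷ xs) f = cong (λ z → f (g x) + z) (∑-map g xs f)

  ∑-cong : ∀ {A : Set} xs {f g : A → ℤ} → (∀ x → f x ≡ g x) → ∑ xs f ≡ ∑ xs g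
  ∑-cong []       f≗g = refl
  ∑-cong (x ∷ xs) f≗g = cong₂ _+_ (f≗g x) (∑-cong xs f≗g)

  ∑-neg : ∀ {A : Set} xs (f : A → ℤ) → ∑ xs (λ x → - f x) ≡ - ∑ xs f
  ∑-neg []       f = refl
  ∑-neg (x ∷ xs) f = trans (cong (λ z → - f x + z) (∑-neg xs f)) (sym (ℤP.neg-distrib-+ (f x) _))

  signIfAdmissible : ℕ → Demand → List Arc → List Bool → ℤ
  signIfAdmissible N δ A s =
    if vanishesBelow N (λ v → δ v + balance (select A s) v) then -1ℤ ^ length (select A s) else 0ℤ

  ∑-masks≡eulerSum : ∀ N δ A → ∑ (masks (length A)) (signIfAdmissible N δ A) ≡ eulerSum N δ A
  ∑-masks≡eulerSum N δ [] =
    trans (ℤP.+-identityʳ _) (cong (if_then 1ℤ else 0ℤ) (vanishesBelow-cong N (λ v → ℤP.+-identityʳ (δ v))))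
  ∑-masks≡eulerSum N δ (a ∷ A) =
    begin
      ∑ (map (true ∷_) M ++ map (false ∷_) M) (signIfAdmissible N δ (a ∷ A))
    ≡⟨ ∑-++ (map (true ∷_) M) (map (false ∷_) M) _ ⟩
      ∑ (map (true ∷_) M) (signIfAdmissible N δ (a ∷ A)) + ∑ (map (false ∷_) M) (signIfAdmissible N δ (a ∷ A))
    ≡⟨ cong₂ _+_ (∑-map (true ∷_) M _) (∑-map (false ∷_) M _) ⟩
      ∑ M (λ s → signIfAdmissible N δ (a ∷ A) (true ∷ s)) + ∑ M (signIfAdmissible N δ A)
    ≡⟨ cong₂ _+_ (trans (∑-cong M withArc) (∑-neg M (signIfAdmissible N (δ ⊕ a) A))) (∑-masks≡eulerSum N δ A) ⟩
      - ∑ M (signIfAdmissible N (δ ⊕ a) A) + eulerSum N δ A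
    ≡⟨ cong (λ z → - z + eulerSum N δ A) (∑-masks≡eulerSum N (δ ⊕ a) A) ⟩
      - eulerSum N (δ ⊕ a) A + eulerSum N δ A
    ≡⟨ ℤP.+-comm (- eulerSum N (δ ⊕ a) A) (eulerSum N δ A) ⟩
      eulerSum N δ (a ∷ A)
    ∎
    where
    open ≡-Reasoning
    M : List (List Bool)
    M = masks (length A)
    if-neg : ∀ (b : Bool) x → (if b then - x else 0ℤ) ≡ - (if b then x else 0ℤ)
    if-neg true  x = refl
    if-neg false x = refl
    withArc : ∀ s → signIfAdmissible N δ (a ∷ A) (true ∷ s) ≡ - signIfAdmissible N (δ ⊕ a) A s
    withArc s = trans
      (cong (if_then -1ℤ ^ suc (length (select A s)) else 0ℤ) (vanishesBelow-cong N (λ v →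
         trans (cong (λ z → δ v + z) (balance-∷ a (select A s) v))
               (solve 4 (λ d b h t → d :+ (b :+ h :- t) := d :+ h :- t :+ b) refl
                      (δ v) (balance (select A s) v) (indicator (proj₂ a) v) (indicator (proj₁ a) v)))))
      (trans (cong (if vanishesBelow N (λ v → (δ ⊕ a) v + balance (select A s) v) then_else 0ℤ)
                   (ℤP.-1*i≡-i (-1ℤ ^ length (select A s))))
             (if-neg _ (-1ℤ ^ length (select A s))))

  -1^-isEven : ∀ n → -1ℤ ^ n ≡ (if isEven n then 1ℤ else -1ℤ)
  -1^-isEven zero          = refl
  -1^-isEven (suc zero)    = refl
  -1^-isEven (suc (suc n)) =
    trans (ℤP.-1*i≡-i (-1ℤ ^ suc n)) (trans (cong -_ (ℤP.-1*i≡-i (-1ℤ ^ n)))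
          (trans (ℤP.neg-involutive (-1ℤ ^ n)) (-1^-isEven n)))

  [i+j]-[k+l]≡[i-k]+[j-l] : ∀ i j k l → (i + j) - (k + l) ≡ (i - k) + (j - l)
  [i+j]-[k+l]≡[i-k]+[j-l] = solve 4 (λ i j k l → (i :+ j) :- (k :+ l) := (i :- k) :+ (j :- l)) refl

  evenMinusOdd≡∑ : ∀ (E : List Bool → Bool) (L : List Bool → ℕ) M →
    + length (filterᵇ (λ s → E s ∧ isEven (L s)) M) - + length (filterᵇ (λ s → E s ∧ not (isEven (L s))) M)
    ≡ ∑ M (λ s → if E s then -1ℤ ^ L s else 0ℤ)
  evenMinusOdd≡∑ E L [] = refl
  evenMinusOdd≡∑ E L (s ∷ M) =
    trans (cong₂ _-_ (count-∷ even s M) (count-∷ odd s M))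
          (trans ([i+j]-[k+l]≡[i-k]+[j-l] (if even s then 1ℤ else 0ℤ) (+ length (filterᵇ even M))
                                          (if odd s then 1ℤ else 0ℤ) (+ length (filterᵇ odd M)))
                 (cong₂ _+_ (trans (parity (E s) (isEven (L s))) (cong (if E s then_else 0ℤ) (sym (-1^-isEven (L s)))))
                            (evenMinusOdd≡∑ E L M)))
    where
    even odd : List Bool → Bool
    even s = E s ∧ isEven (L s)
    odd  s = E s ∧ not (isEven (L s))
    parity : ∀ e b → (if e ∧ b then 1ℤ else 0ℤ) - (if e ∧ not b then 1ℤ else 0ℤ)
                     ≡ (if e then (if b then 1ℤ else -1ℤ) else 0ℤ)
    parity false _     = refl
    parity true  true  = refl
    parity true  false = refl

  evenMinusOdd≡eulerSum : ∀ N A → + evenEulerian N A - + oddEulerian N A ≡ eulerSum N zeroDemand A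
  evenMinusOdd≡eulerSum N A =
    trans (evenMinusOdd≡∑ (λ s → isEulerian N (select A s)) (λ s → length (select A s)) (masks (length A)))
          (trans (∑-cong (masks (length A)) λ s →
                    cong (if_then -1ℤ ^ length (select A s) else 0ℤ)
                         (trans (isEulerian≡vanishesBelow N (select A s))
                                (vanishesBelow-cong N (λ v → sym (ℤP.+-identityˡ _)))))
                 (∑-masks≡eulerSum N zeroDemand A))

  eulerSum≡1⇒AlonTarsi : ∀ N A → eulerSum N zeroDemand A ≡ 1ℤ → AlonTarsi N A
  eulerSum≡1⇒AlonTarsi N A σ≡1 even≡odd with
    trans (sym (ℤP.+-inverseʳ (+ oddEulerian N A)))
          (trans (cong (λ n → + n - + oddEulerian N A) (sym even≡odd)) (trans (evenMinusOdd≡eulerSum N A) σ≡1))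
  ... | ()

module ListProperties where

  open import Data.List using ([]; _∷_; _++_; filter)
  open import Data.List.Relation.Unary.All using (All; []; _∷_)
  import Data.List.Relation.Unary.All.Properties as AllP
  open import Data.List.Relation.Unary.AllPairs using (AllPairs; []; _∷_)
  open import Data.List.Relation.Binary.Permutation.Propositional using (_↭_; ↭-refl; ↭-sym; ↭-trans; ↭-prep)
  import Data.List.Relation.Binary.Permutation.Propositional.Properties as ↭P
  open import Data.Product using (_×_; _,_)
  open import Function using (_∘_)
  open import Relation.Nullary using (yes; no; ¬?)
  open import Relation.Unary using (Decidable)

  ↭-filter-partition : ∀ {A : Set} {Q : A → Set} (Q? : Decidable Q) xs → xs ↭ filter (¬? ∘ Q?) xs ++ filter Q? xs
  ↭-filter-partition Q? []       = ↭-refl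
  ↭-filter-partition Q? (x ∷ xs) with Q? x
  ... | no  _ = ↭-prep x (↭-filter-partition Q? xs)
  ... | yes _ = ↭-trans (↭-prep x (↭-filter-partition Q? xs)) (↭-sym (↭P.shift x (filter (¬? ∘ Q?) xs) (filter Q? xs)))

  AllPairs-++⁻ : ∀ {A : Set} {R : A → A → Set} xs {ys} → AllPairs R (xs ++ ys) →
                 AllPairs R xs × AllPairs R ys × All (λ x → All (R x) ys) xs
  AllPairs-++⁻ []       Rys          = [] , Rys , []
  AllPairs-++⁻ (x ∷ xs) (Rx ∷ Rxsys) with AllPairs-++⁻ xs Rxsys
  ... | Rxs , Rys , Rxsys′ = (AllP.++⁻ˡ xs Rx ∷ Rxs) , Rys , (AllP.++⁻ʳ xs Rx ∷ Rxsys′)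

module Paths where

  open EulerSum using (Arc; path)
  open import Data.Nat as ℕ using (ℕ; zero; suc; _+_; _<_; _≤_; s≤s)
  import Data.Nat.Properties as ℕP
  open import Data.List using (List; []; _∷_; _++_; [_]; length; map; reverse)
  import Data.List.Properties as LP
  open import Data.List.Membership.Propositional using (_∈_)
  open import Data.List.Relation.Unary.Any using (here; there)
  open import Data.List.Relation.Unary.All as All using (All; []; _∷_)
  import Data.List.Relation.Unary.All.Properties as AllP
  open import Data.List.Relation.Unary.AllPairs using (AllPairs; []; _∷_)
  open import Data.List.Relation.Binary.Permutation.Propositional using (_↭_; ↭-refl; ↭-sym)
  import Data.List.Relation.Binary.Permutation.Propositional.Properties as ↭P
  open import Data.Product using (_×_; _,_; proj₁; proj₂; swap)
  open import Data.Sum using (inj₁; inj₂)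
  open import Data.Empty using (⊥-elim)
  open import Relation.Binary.PropositionalEquality hiding ([_])

  consecutive : ℕ → ℕ → List ℕ
  consecutive a zero    = []
  consecutive a (suc k) = a ∷ consecutive (suc a) k

  length-consecutive : ∀ a k → length (consecutive a k) ≡ k
  length-consecutive a zero    = refl
  length-consecutive a (suc k) = cong suc (length-consecutive (suc a) k)

  consecutive-∷ʳ : ∀ a k → consecutive a (suc k) ≡ consecutive a k ++ [ a + k ]
  consecutive-∷ʳ a zero    = cong [_] (sym (ℕP.+-identityʳ a))
  consecutive-∷ʳ a (suc k) =
    cong (a ∷_) (trans (consecutive-∷ʳ (suc a) k) (cong (λ z → consecutive (suc a) k ++ [ z ]) (sym (ℕP.+-suc a k))))

  consecutive-bounds : ∀ a k → All (λ x → a ≤ x × x < a + k) (consecutive a k)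
  consecutive-bounds a zero    = []
  consecutive-bounds a (suc k) =
    (ℕP.≤-refl , subst (a <_) (sym (ℕP.+-suc a k)) (s≤s (ℕP.m≤m+n a k))) ∷
    All.map (λ { {x} (a<x , x<1+a+k) → ℕP.<⇒≤ a<x , subst (x <_) (sym (ℕP.+-suc a k)) x<1+a+k })
            (consecutive-bounds (suc a) k)

  consecutive-sorted : ∀ a k → AllPairs _<_ (consecutive a k)
  consecutive-sorted a zero    = []
  consecutive-sorted a (suc k) = All.map proj₁ (consecutive-bounds (suc a) k) ∷ consecutive-sorted (suc a) k

  ∈-consecutive : ∀ {a k x} → a ≤ x → x < a + k → x ∈ consecutive a k
  ∈-consecutive {a} {zero}  a≤x x<a+0 =
    ⊥-elim (ℕP.<-irrefl refl (ℕP.<-≤-trans x<a+0 (subst (_≤ _) (sym (ℕP.+-identityʳ a)) a≤x)))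
  ∈-consecutive {a} {suc k} {x} a≤x x<a+k with ℕP.m≤n⇒m<n∨m≡n a≤x
  ... | inj₂ refl = here refl
  ... | inj₁ a<x  = there (∈-consecutive a<x (subst (x <_) (ℕP.+-suc a k) x<a+k))

  path-++ : ∀ xs y ys → path (xs ++ y ∷ ys) ≡ path (xs ++ [ y ]) ++ path (y ∷ ys)
  path-++ []           y ys = refl
  path-++ (x ∷ [])     y ys = refl
  path-++ (x ∷ x′ ∷ xs) y ys = cong ((x , x′) ∷_) (path-++ (x′ ∷ xs) y ys)

  length-path : ∀ x ys → length (path (x ∷ ys)) ≡ length ys
  length-path x []       = refl
  length-path x (y ∷ ys) = cong suc (length-path y ys)

  map-proj₁-path : ∀ x xs y → map proj₁ (path (x ∷ xs ++ [ y ])) ≡ x ∷ xs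
  map-proj₁-path x []        y = refl
  map-proj₁-path x (x′ ∷ xs) y = cong (x ∷_) (map-proj₁-path x′ xs y)

  map-proj₂-path : ∀ x xs → map proj₂ (path (x ∷ xs)) ≡ xs
  map-proj₂-path x []        = refl
  map-proj₂-path x (x′ ∷ xs) = cong (x′ ∷_) (map-proj₂-path x′ xs)

  All-path : ∀ {P : ℕ → Set} {zs} → All P zs → All (λ a → P (proj₁ a) × P (proj₂ a)) (path zs)
  All-path []                 = []
  All-path (px ∷ [])          = []
  All-path (px ∷ py ∷ pzs)    = (px , py) ∷ All-path (py ∷ pzs)

  All-proj₁-path : ∀ {P : ℕ → Set} {xs} y → All P xs → All (λ a → P (proj₁ a)) (path (xs ++ [ y ]))
  All-proj₁-path y []               = []
  All-proj₁-path y (px ∷ [])        = px ∷ []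
  All-proj₁-path y (px ∷ px′ ∷ pxs) = px ∷ All-proj₁-path y (px′ ∷ pxs)

  reverse-map-swap-path : ∀ zs → reverse (map swap (path zs)) ≡ path (reverse zs)
  reverse-map-swap-path []           = refl
  reverse-map-swap-path (x ∷ [])     = refl
  reverse-map-swap-path (x ∷ y ∷ zs) =
    begin
      reverse (map swap (path (x ∷ y ∷ zs)))
    ≡⟨ LP.reverse-++ [ (y , x) ] (map swap (path (y ∷ zs))) ⟩
      reverse (map swap (path (y ∷ zs))) ++ [ (y , x) ]
    ≡⟨ cong (_++ [ (y , x) ]) (reverse-map-swap-path (y ∷ zs)) ⟩
      path (reverse (y ∷ zs)) ++ [ (y , x) ]
    ≡⟨ cong (λ z → path z ++ [ (y , x) ]) (LP.unfold-reverse y zs) ⟩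
      path (reverse zs ++ [ y ]) ++ [ (y , x) ]
    ≡⟨ sym (path-++ (reverse zs) y [ x ]) ⟩
      path (reverse zs ++ y ∷ x ∷ [])
    ≡⟨ cong path (sym (LP.++-assoc (reverse zs) [ y ] [ x ])) ⟩
      path ((reverse zs ++ [ y ]) ++ [ x ])
    ≡⟨ cong (λ z → path (z ++ [ x ])) (sym (LP.unfold-reverse y zs)) ⟩
      path (reverse (y ∷ zs) ++ [ x ])
    ≡⟨ cong path (sym (LP.unfold-reverse x (y ∷ zs))) ⟩
      path (reverse (x ∷ y ∷ zs))
    ∎
    where open ≡-Reasoning

  map-swap-path↭ : ∀ zs → map swap (path zs) ↭ path (reverse zs)
  map-swap-path↭ zs =
    subst (map swap (path zs) ↭_) (reverse-map-swap-path zs) (↭-sym (↭P.↭-reverse (map swap (path zs))))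

  cycle : List ℕ → List Arc
  cycle []       = []
  cycle (x ∷ xs) = path (x ∷ xs ++ [ x ])

  cycleEdges≡cycle : ∀ xs → cycleEdges xs ≡ cycle xs
  cycleEdges≡cycle []           = refl
  cycleEdges≡cycle (x ∷ [])     = refl
  cycleEdges≡cycle (x ∷ y ∷ []) = refl
  cycleEdges≡cycle (x ∷ y ∷ z ∷ zs) =
    cong (λ arcs → (x , y) ∷ (y , z) ∷ arcs) (LP.∷-injectiveʳ (cycleEdges≡cycle (x ∷ z ∷ zs)))

  cycle-rotate : ∀ xs ys → cycle (xs ++ ys) ↭ cycle (ys ++ xs)
  cycle-rotate [] ys rewrite LP.++-identityʳ ys = ↭-refl
  cycle-rotate (x ∷ xs) [] rewrite LP.++-identityʳ xs = ↭-refl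
  cycle-rotate (x ∷ xs) (y ∷ ys) =
    subst₂ _↭_ (sym (halves x xs y ys)) (sym (halves y ys x xs))
           (↭P.++-comm (path (x ∷ xs ++ [ y ])) (path (y ∷ ys ++ [ x ])))
    where
    halves : ∀ x xs y ys → cycle ((x ∷ xs) ++ y ∷ ys) ≡ path (x ∷ xs ++ [ y ]) ++ path (y ∷ ys ++ [ x ])
    halves x xs y ys = trans (cong (λ zs → path (x ∷ zs)) (LP.++-assoc xs (y ∷ ys) [ x ]))
                             (path-++ (x ∷ xs) y (ys ++ [ x ]))

  All-cycle : ∀ {P : ℕ → Set} {zs} → All P zs → All (λ a → P (proj₁ a) × P (proj₂ a)) (cycle zs)
  All-cycle []         = []
  All-cycle (px ∷ pxs) = All-path (px ∷ AllP.++⁺ pxs (px ∷ []))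

  length-cycle : ∀ xs → length (cycle xs) ≡ length xs
  length-cycle []       = refl
  length-cycle (x ∷ xs) = trans (length-path x (xs ++ [ x ])) (trans (LP.length-++ xs) (ℕP.+-comm (length xs) 1))

module Occurrences where

  open import Data.Nat as ℕ using (ℕ; suc; _+_; _≤_; z≤n; s≤s; _≡ᵇ_)
  import Data.Nat.Properties as ℕP
  open import Data.Bool using (true; false; T)
  open import Data.Bool.Properties using (T?)
  open import Data.List using (List; []; _∷_; _++_; length; map; filterᵇ)
  import Data.List.Properties as LP
  open import Data.List.Membership.Propositional using (_∈_)
  open import Data.List.Relation.Unary.Any using (here; there)
  open import Data.List.Relation.Unary.All as All using (All; []; _∷_)
  open import Data.List.Relation.Unary.AllPairs using (AllPairs; []; _∷_)
  open import Data.List.Relation.Binary.Permutation.Propositional using (_↭_)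
  import Data.List.Relation.Binary.Permutation.Propositional.Properties as ↭P
  open import Data.Product using (proj₁)
  open import Function using (_∘_)
  open import Relation.Binary.PropositionalEquality

  occurrences : ℕ → List ℕ → ℕ
  occurrences v = length ∘ filterᵇ (_≡ᵇ v)

  occurrences-++ : ∀ v xs ys → occurrences v (xs ++ ys) ≡ occurrences v xs + occurrences v ys
  occurrences-++ v xs ys =
    trans (cong length (LP.filter-++ (T? ∘ (_≡ᵇ v)) xs ys)) (LP.length-++ (filterᵇ (_≡ᵇ v) xs))

  occurrences-absent : ∀ {v xs} → All (_≢ v) xs → occurrences v xs ≡ 0
  occurrences-absent {v} ≢v =
    cong length (LP.filter-none (T? ∘ (_≡ᵇ v)) (All.map (λ x≢v → x≢v ∘ ℕP.≡ᵇ⇒≡ _ _) ≢v))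

  occurrences-present : ∀ {v xs} → v ∈ xs → 1 ≤ occurrences v xs
  occurrences-present {v} {x ∷ xs} (here refl) rewrite LP.filter-accept (T? ∘ (_≡ᵇ v)) {v} {xs} (ℕP.≡⇒≡ᵇ v v refl) =
    s≤s z≤n
  occurrences-present {v} {x ∷ xs} (there v∈xs) with x ≡ᵇ v
  ... | true  = s≤s z≤n
  ... | false = occurrences-present v∈xs

  occurrences-distinct : ∀ v {xs} → AllPairs _≢_ xs → occurrences v xs ≤ 1
  occurrences-distinct v {[]}     [] = z≤n
  occurrences-distinct v {x ∷ xs} (x≢xs ∷ distinct) with x ≡ᵇ v in x≡ᵇv
  ... | true  = s≤s (ℕP.≤-reflexive (occurrences-absent
                  (All.map (λ x≢y y≡v → x≢y (trans (ℕP.≡ᵇ⇒≡ x v (subst T (sym x≡ᵇv) _)) (sym y≡v))) x≢xs)))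
  ... | false = occurrences-distinct v distinct

  occurrences-↭ : ∀ v {xs ys} → xs ↭ ys → occurrences v xs ≡ occurrences v ys
  occurrences-↭ v xs↭ys = ↭P.↭-length (↭P.filter-↭ (T? ∘ (_≡ᵇ v)) xs↭ys)

  outdeg≡occurrences : ∀ v X → outdeg v X ≡ occurrences v (map proj₁ X)
  outdeg≡occurrences v []      = refl
  outdeg≡occurrences v (a ∷ X) with proj₁ a ≡ᵇ v
  ... | true  = cong suc (outdeg≡occurrences v X)
  ... | false = outdeg≡occurrences v X

module Orientations where

  open EulerSum using (Arc)
  open import Data.Nat using (ℕ; suc)
  import Data.Nat.Properties as ℕP
  open import Data.Bool using (Bool; true; false; if_then_else_)
  open import Data.List using ([]; _∷_; length; map)
  open import Data.List.Relation.Unary.All using (All; []; _∷_)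
  open import Data.Product using (_×_; _,_; proj₁; proj₂; swap)
  open import Relation.Binary.PropositionalEquality

  orient-map : ∀ (g : Arc → Bool) es → orient es (map g es) ≡ map (λ e → if g e then e else swap e) es
  orient-map g []             = refl
  orient-map g ((u , v) ∷ es) with g (u , v)
  ... | true  = cong ((u , v) ∷_) (orient-map g es)
  ... | false = cong ((v , u) ∷_) (orient-map g es)

  orient-tails : ∀ {P : ℕ → Set} es bs → All (λ e → P (proj₁ e) × P (proj₂ e)) es →
                 All (λ a → P (proj₁ a)) (orient es bs)
  orient-tails []              bs           _               = []
  orient-tails (_ ∷ _)         []           _               = []
  orient-tails ((u , v) ∷ es) (true  ∷ bs) ((pu , _) ∷ pes) = pu ∷ orient-tails es bs pes
  orient-tails ((u , v) ∷ es) (false ∷ bs) ((_ , pv) ∷ pes) = pv ∷ orient-tails es bs pes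

  length-orient : ∀ es bs → length bs ≡ length es → length (orient es bs) ≡ length es
  length-orient []             bs           _       = refl
  length-orient ((u , v) ∷ es) (true  ∷ bs) |bs|≡ = cong suc (length-orient es bs (ℕP.suc-injective |bs|≡))
  length-orient ((u , v) ∷ es) (false ∷ bs) |bs|≡ = cong suc (length-orient es bs (ℕP.suc-injective |bs|≡))

module OutdegreeSum where

  open Orientations using (orient-tails; length-orient)
  open import Data.Nat as ℕ using (ℕ; zero; suc; _+_; _<_; _≤_; z≤n; _≡ᵇ_; _≟_)
  import Data.Nat.Properties as ℕP
  open import Algebra.Properties.CommutativeSemigroup ℕP.+-commutativeSemigroup using (interchange)
  open import Data.Bool using (true; false; if_then_else_)
  open import Data.Sum using (inj₁; inj₂)
  open import Relation.Nullary using (does)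
  open import Relation.Nullary.Decidable using (dec-true; dec-false)
  open import Data.List using (List; []; _∷_; length)
  open EulerSum using (Arc)
  open import Data.List.Relation.Unary.All using (All; []; _∷_)
  open import Data.Vec using (toList)
  import Data.Vec.Properties as VecP
  open import Data.Product using (_×_; _,_; proj₁; proj₂)
  open import Relation.Binary.PropositionalEquality
  open import Relation.Nullary using (¬_)

  sumBelow : ℕ → (ℕ → ℕ) → ℕ
  sumBelow zero    f = 0
  sumBelow (suc n) f = f n + sumBelow n f

  sumBelow-cong : ∀ n {f g : ℕ → ℕ} → (∀ v → f v ≡ g v) → sumBelow n f ≡ sumBelow n g
  sumBelow-cong zero    f≗g = refl
  sumBelow-cong (suc n) f≗g = cong₂ _+_ (f≗g n) (sumBelow-cong n f≗g)

  sumBelow-≤ : ∀ n (f : ℕ → ℕ) → (∀ v → v < n → f v ≤ 1) → sumBelow n f ≤ n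
  sumBelow-≤ zero    f f≤1 = z≤n
  sumBelow-≤ (suc n) f f≤1 = ℕP.+-mono-≤ (f≤1 n (ℕP.n<1+n n)) (sumBelow-≤ n f (λ v v<n → f≤1 v (ℕP.m<n⇒m<1+n v<n)))

  sumBelow-+ : ∀ n f g → sumBelow n (λ v → f v + g v) ≡ sumBelow n f + sumBelow n g
  sumBelow-+ zero    f g = refl
  sumBelow-+ (suc n) f g = trans (cong (f n + g n +_) (sumBelow-+ n f g)) (interchange (f n) (g n) (sumBelow n f) (sumBelow n g))

  isAt : ℕ → ℕ → ℕ
  isAt t v = if does (t ≟ v) then 1 else 0

  sumBelow-isAt-above : ∀ {n t} → n ≤ t → sumBelow n (isAt t) ≡ 0
  sumBelow-isAt-above {zero}      _   = refl
  sumBelow-isAt-above {suc n} {t} n<t rewrite dec-false (t ≟ n) (≢-sym (ℕP.<⇒≢ n<t)) = sumBelow-isAt-above (ℕP.<⇒≤ n<t)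

  sumBelow-isAt-below : ∀ {n t} → t < n → sumBelow n (isAt t) ≡ 1
  sumBelow-isAt-below {suc n} {t} t<1+n with ℕP.m≤n⇒m<n∨m≡n (ℕP.≤-pred t<1+n)
  ... | inj₂ refl rewrite dec-true (t ≟ t) refl = cong suc (sumBelow-isAt-above {t} ℕP.≤-refl)
  ... | inj₁ t<n  rewrite dec-false (t ≟ n) (ℕP.<⇒≢ t<n) = sumBelow-isAt-below t<n

  outdeg-∷ : ∀ a X v → outdeg v (a ∷ X) ≡ isAt (proj₁ a) v + outdeg v X
  outdeg-∷ a X v with proj₁ a ≡ᵇ v
  ... | true  = refl
  ... | false = refl

  sumBelow-outdeg : ∀ N X → All (λ a → proj₁ a < N) X → sumBelow N (λ v → outdeg v X) ≡ length X
  sumBelow-outdeg N []      _          = sumBelow-zero N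
    where
    sumBelow-zero : ∀ n → sumBelow n (λ _ → 0) ≡ 0
    sumBelow-zero zero    = refl
    sumBelow-zero (suc n) = sumBelow-zero n
  sumBelow-outdeg N (a ∷ X) (t<N ∷ ts) =
    trans (sumBelow-cong N (outdeg-∷ a X))
          (trans (sumBelow-+ N (isAt (proj₁ a)) (λ v → outdeg v X))
                 (cong₂ _+_ (sumBelow-isAt-below t<N) (sumBelow-outdeg N X ts)))

  -- with outdegrees at most 1 there are at most as many arcs as vertices
  moreEdgesThanVertices⇒AT≥3 : ∀ G → All (λ e → proj₁ e < nV G × proj₂ e < nV G) (edges G) → nV G < length (edges G) →
                               ∀ j → j < 3 → ¬ HasATOrientation G j
  moreEdgesThanVertices⇒AT≥3 G bounded N<|E| j j<3 (o , outdeg<j , _) = ℕP.<-irrefl refl (begin-strict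
      nV G                                 <⟨ N<|E| ⟩
      length (edges G)                     ≡⟨ sym |X|≡|E| ⟩
      length X                             ≡⟨ sym (sumBelow-outdeg (nV G) X tails<N) ⟩
      sumBelow (nV G) (λ v → outdeg v X)   ≤⟨ sumBelow-≤ (nV G) (λ v → outdeg v X) outdeg≤1 ⟩
      nV G                                 ∎)
    where
    open ℕP.≤-Reasoning
    X : List Arc
    X = orient (edges G) (toList o)
    outdeg≤1 : ∀ v → v < nV G → outdeg v X ≤ 1
    outdeg≤1 v v<N = ℕP.≤-pred (ℕP.≤-trans (outdeg<j v v<N) (ℕP.≤-pred j<3))
    tails<N : All (λ a → proj₁ a < nV G) X
    tails<N = orient-tails (edges G) (toList o) bounded
    |X|≡|E| : length X ≡ length (edges G)
    |X|≡|E| = length-orient (edges G) (toList o) (VecP.length-toList o)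

module Fans where

  open EulerSum
  open Paths using (consecutive)
  open import Data.Nat as ℕ using (ℕ; zero; suc; _+_; _<_; _≤_)
  import Data.Nat.Properties as ℕP
  open import Data.Integer as ℤ using (ℤ; _-_; _*_; _^_; 0ℤ; 1ℤ; -1ℤ)
  import Data.Integer.Properties as ℤP
  open import Data.Integer.Solver using (module +-*-Solver)
  open +-*-Solver using (solve; _:+_; _:-_; _:=_; con)
  open import Data.List using (List; []; _∷_; _++_; map)
  open import Data.List.Relation.Unary.All as All using (All; []; _∷_)
  open import Data.List.Relation.Binary.Permutation.Propositional using (_↭_; ↭-refl; ↭-trans; ↭-prep; ↭-swap)
  import Data.List.Relation.Binary.Permutation.Propositional.Properties as ↭P
  open import Data.Product using (_×_; _,_; proj₁; proj₂)
  import Data.Sum as Sum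
  open Sum using (_⊎_; inj₁; inj₂)
  open import Relation.Binary.PropositionalEquality

  -- the fan below P with rim a, a+1, …, a+j, without the arc P → a
  zigzag : ℕ → ℕ → ℕ → List Arc
  zigzag P a zero    = []
  zigzag P a (suc j) = (a , suc a) ∷ (suc a , P) ∷ zigzag P (suc a) j

  spokes++rim↭zigzag : ∀ P a j → map (_, P) (consecutive (suc a) j) ++ path (consecutive a (suc j)) ↭ zigzag P a j
  spokes++rim↭zigzag P a zero    = ↭-refl
  spokes++rim↭zigzag P a (suc j) =
    ↭-trans (↭-prep (suc a , P) (↭P.shift (a , suc a) (map (_, P) (consecutive (suc (suc a)) j))
                                                      (path (consecutive (suc a) (suc j)))))
    (↭-trans (↭-swap (suc a , P) (a , suc a) ↭-refl)
             (↭-prep (a , suc a) (↭-prep (suc a , P) (spokes++rim↭zigzag P (suc a) j))))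

  zigzag-bounds : ∀ P a j → All (λ e → a ≤ proj₁ e × (proj₂ e ≡ P ⊎ a < proj₂ e)) (zigzag P a j)
  zigzag-bounds P a zero    = []
  zigzag-bounds P a (suc j) = (ℕP.≤-refl , inj₂ (ℕP.n<1+n a)) ∷ (ℕP.n≤1+n a , inj₁ refl) ∷
    All.map (λ { (1+a≤t , head) → ℕP.<⇒≤ 1+a≤t , Sum.map₂ (ℕP.<-trans (ℕP.n<1+n a)) head })
            (zigzag-bounds P (suc a) j)

  zigzag-tailFree : ∀ {P a j v} → v < a → All (λ e → proj₁ e ≢ v) (zigzag P a j)
  zigzag-tailFree {P} {a} {j} v<a =
    All.map (λ { (a≤t , _) t≡v → ℕP.<⇒≢ (ℕP.<-≤-trans v<a a≤t) (sym t≡v) }) (zigzag-bounds P a j)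

  zigzag-headFree : ∀ {P a j v} → P ≢ v → v ≤ a → All (λ e → proj₂ e ≢ v) (zigzag P a j)
  zigzag-headFree {P} {a} {j} P≢v v≤a =
    All.map (λ { (_ , inj₁ refl) → P≢v ; (_ , inj₂ a<h) → λ h≡v → ℕP.<⇒≢ (ℕP.≤-<-trans v≤a a<h) (sym h≡v) })
            (zigzag-bounds P a j)

  eulerSum-zigzag : ∀ N P a j → P < a → a + j < N → eulerSum N zeroDemand (zigzag P a j) ≡ 1ℤ
  eulerSum-zigzag N P a zero    P<a a+j<N = eulerSum-zeroDemand-[] N
  eulerSum-zigzag N P a (suc j) P<a a+j<N =
    cong₂ _-_ (cong₂ _-_ (eulerSum-zigzag N P (suc a) j P<1+a 1+a+j<N)
                         (eulerSum-⊕-noExit zeroDemand (zigzag P (suc a) j) (ℕP.<-trans P<a a<N) refl (≢-sym (ℕP.<⇒≢ P<1+a))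
                                            (zigzag-tailFree P<1+a)))
              (eulerSum-⊕-noReturn zeroDemand ((suc a , P) ∷ zigzag P (suc a) j) a<N refl (ℕP.<⇒≢ (ℕP.n<1+n a))
                                   (ℕP.<⇒≢ P<a ∷ zigzag-headFree (ℕP.<⇒≢ P<a) (ℕP.n≤1+n a)))
    where
    P<1+a : P < suc a
    P<1+a = ℕP.<-trans P<a (ℕP.n<1+n a)
    1+a+j<N : suc a + j < N
    1+a+j<N = subst (_< N) (ℕP.+-suc a j) a+j<N
    a<N : a < N
    a<N = ℕP.≤-<-trans (ℕP.m≤m+n a (suc j)) a+j<N

  parity : ℕ → ℤ
  parity zero    = 0ℤ
  parity (suc j) = 1ℤ - parity j

  parity-sign : ∀ j → (parity j ≡ 0ℤ × -1ℤ ^ j ≡ 1ℤ) ⊎ (parity j ≡ 1ℤ × -1ℤ ^ j ≡ -1ℤ)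
  parity-sign zero = inj₁ (refl , refl)
  parity-sign (suc j) with parity-sign j
  ... | inj₁ (p≡0 , s≡1)  = inj₂ (cong (1ℤ -_) p≡0 , cong (-1ℤ *_) s≡1)
  ... | inj₂ (p≡1 , s≡-1) = inj₁ (cong (1ℤ -_) p≡1 , cong (-1ℤ *_) s≡-1)

  eulerSum-zigzag-from : ∀ N P a j → P < a → a + j < N → eulerSum N (zeroDemand ⊕ (P , a)) (zigzag P a j) ≡ parity j
  eulerSum-zigzag-from N P a zero P<a a+0<N =
    eulerSum-[]-nonvanishing (subst (_< N) (ℕP.+-identityʳ a) a+0<N)
      (≢-sym (ℤP.<⇒≢ (⊕-head-positive zeroDemand (ℕP.<⇒≢ P<a) ℤP.≤-refl)))
  eulerSum-zigzag-from N P a (suc j) P<a a+j<N =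
    begin
      eulerSum N D rest - eulerSum N (D ⊕ (a , suc a)) rest
    ≡⟨ cong₂ _-_ (eulerSum-⊕-noExit zeroDemand rest a<N refl (ℕP.<⇒≢ P<a)
                                    (≢-sym (ℕP.<⇒≢ (ℕP.n<1+n a)) ∷ zigzag-tailFree (ℕP.n<1+n a)))
                 (eulerSum-cong N rest (λ v → solve 3 (λ x y w → con 0ℤ :+ x :- y :+ w :- x := con 0ℤ :+ w :- y) refl
                                                   (indicator a v) (indicator P v) (indicator (suc a) v))) ⟩
      0ℤ - (eulerSum N D′ W - eulerSum N (D′ ⊕ (suc a , P)) W)
    ≡⟨ cong (0ℤ -_) (cong₂ _-_ (eulerSum-zigzag-from N P (suc a) j P<1+a 1+a+j<N)
         (trans (eulerSum-cong N W (λ v → solve 2 (λ x y → con 0ℤ :+ x :- y :+ y :- x := con 0ℤ) refl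
                                                  (indicator (suc a) v) (indicator P v)))
                (eulerSum-zigzag N P (suc a) j P<1+a 1+a+j<N))) ⟩
      0ℤ - (parity j - 1ℤ)
    ≡⟨ solve 1 (λ x → con 0ℤ :- (x :- con 1ℤ) := con 1ℤ :- x) refl (parity j) ⟩
      1ℤ - parity j
    ∎
    where
    open ≡-Reasoning
    D D′ : Demand
    D  = zeroDemand ⊕ (P , a)
    D′ = zeroDemand ⊕ (P , suc a)
    W rest : List Arc
    W    = zigzag P (suc a) j
    rest = (suc a , P) ∷ W
    P<1+a : P < suc a
    P<1+a = ℕP.<-trans P<a (ℕP.n<1+n a)
    1+a+j<N : suc a + j < N
    1+a+j<N = subst (_< N) (ℕP.+-suc a j) a+j<N
    a<N : a < N
    a<N = ℕP.≤-<-trans (ℕP.m≤m+n a (suc j)) a+j<N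

  eulerSum-spokeZigzag-to : ∀ N P b j c → P < b → c ≡ b + j → c < N →
                            eulerSum N (zeroDemand ⊕ (P , c)) ((b , P) ∷ zigzag P b j) ≡ -1ℤ
  eulerSum-zigzag-to      : ∀ N P a j c → P < a → c ≡ a + suc j → c < N →
                            eulerSum N (zeroDemand ⊕ (P , c)) (zigzag P a (suc j)) ≡ -1ℤ
  eulerSum-spokeZigzag-to N P b zero c P<b c≡b+0 c<N with trans c≡b+0 (ℕP.+-identityʳ b)
  ... | refl =
    cong₂ _-_ (eulerSum-[]-nonvanishing c<N (≢-sym (ℤP.<⇒≢ (⊕-head-positive zeroDemand (ℕP.<⇒≢ P<b) ℤP.≤-refl))))
              (trans (eulerSum-cong N [] (λ v → solve 2 (λ x y → con 0ℤ :+ x :- y :+ y :- x := con 0ℤ) refl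
                                                        (indicator c v) (indicator P v)))
                     (eulerSum-zeroDemand-[] N))
  eulerSum-spokeZigzag-to N P b (suc j) c P<b c≡b+j c<N =
    cong₂ _-_ (eulerSum-zigzag-to N P b j c P<b c≡b+j c<N)
              (eulerSum-⊕-noReturn (zeroDemand ⊕ (P , c)) (zigzag P b (suc j)) (ℕP.<-trans b<c c<N)
                 (⊕-elsewhere zeroDemand (ℕP.<⇒≢ P<b) (≢-sym (ℕP.<⇒≢ b<c))) (≢-sym (ℕP.<⇒≢ P<b))
                 (zigzag-headFree (ℕP.<⇒≢ P<b) ℕP.≤-refl))
    where
    b<c : b < c
    b<c = subst (b <_) (sym c≡b+j) (ℕP.m<m+n b ℕ.z<s)
  eulerSum-zigzag-to N P a j c P<a c≡a+1+j c<N =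
    cong₂ _-_ (eulerSum-spokeZigzag-to N P (suc a) j c P<1+a (trans c≡a+1+j (ℕP.+-suc a j)) c<N)
              (eulerSum-⊕-noReturn (zeroDemand ⊕ (P , c)) ((suc a , P) ∷ zigzag P (suc a) j) (ℕP.<-trans a<c c<N)
                 (⊕-elsewhere zeroDemand (ℕP.<⇒≢ P<a) (≢-sym (ℕP.<⇒≢ a<c))) (ℕP.<⇒≢ (ℕP.n<1+n a))
                 (ℕP.<⇒≢ P<a ∷ zigzag-headFree (ℕP.<⇒≢ P<a) (ℕP.n≤1+n a)))
    where
    P<1+a : P < suc a
    P<1+a = ℕP.<-trans P<a (ℕP.n<1+n a)
    a<c : a < c
    a<c = subst (a <_) (sym c≡a+1+j) (ℕP.m<m+n a ℕ.z<s)

  eulerSum-fan : ∀ N P a j → P < a → a + j < N → eulerSum N zeroDemand ((P , a) ∷ zigzag P a j) ≡ 1ℤ - parity j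
  eulerSum-fan N P a j P<a a+j<N = cong₂ _-_ (eulerSum-zigzag N P a j P<a a+j<N) (eulerSum-zigzag-from N P a j P<a a+j<N)

  eulerSum-fan-chord : ∀ N P a j c → P < a → c ≡ a + suc j → c < N →
                       eulerSum N (zeroDemand ⊕ (a , c)) ((P , a) ∷ zigzag P a (suc j)) ≡ 1ℤ
  eulerSum-fan-chord N P a j c P<a c≡a+1+j c<N =
    cong₂ _-_ (eulerSum-⊕-noReturn zeroDemand (zigzag P a (suc j)) (ℕP.<-trans a<c c<N) refl (ℕP.<⇒≢ a<c)
                                   (zigzag-headFree (ℕP.<⇒≢ P<a) ℕP.≤-refl))
              (trans (eulerSum-cong N (zigzag P a (suc j))
                       (λ v → solve 3 (λ x y w → con 0ℤ :+ x :- y :+ y :- w := con 0ℤ :+ x :- w) refl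
                                      (indicator c v) (indicator a v) (indicator P v)))
                     (eulerSum-zigzag-to N P a j c P<a c≡a+1+j c<N))
    where
    a<c : a < c
    a<c = subst (a <_) (sym c≡a+1+j) (ℕP.m<m+n a ℕ.z<s)

module Labelling where

  open EulerSum using (Arc)
  open import Data.Nat as ℕ using (ℕ; suc; _+_; _<_; _≤_; s≤s)
  import Data.Nat.Properties as ℕP
  open import Data.Nat.Tactic.RingSolver using (solve-∀)
  open import Data.List using (List; []; _∷_; _++_; map; length)
  import Data.List.Properties as LP
  open import Data.List.Relation.Unary.All as All using (All; []; _∷_)
  import Data.List.Relation.Unary.All.Properties as AllP
  open import Data.List.Relation.Unary.AllPairs using (AllPairs; []; _∷_)
  import Data.List.Relation.Unary.AllPairs.Properties as AllPairsP
  open import Data.Product using (_×_; _,_; proj₁; proj₂)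
  open import Data.Sum using (_⊎_; inj₁; inj₂; [_,_]′)
  open import Relation.Binary.PropositionalEquality

  Labelled : Set
  Labelled = ℕ × List Arc × List ℕ

  next : Labelled → ℕ
  next = proj₁

  edgesOf : Labelled → List Arc
  edgesOf r = proj₁ (proj₂ r)

  leavesOf : Labelled → List ℕ
  leavesOf r = proj₂ (proj₂ r)

  -- what labelF ts p n satisfies: the forest ts hangs below p and is numbered from n on
  record ForestLabelling (p n : ℕ) (r : Labelled) : Set where
    field
      size             : next r ≡ length (edgesOf r) + n
      edges-bounded    : All (λ e → (proj₁ e ≡ p ⊎ n ≤ proj₁ e) × proj₁ e < proj₂ e ×
                                    n ≤ proj₂ e × proj₂ e < next r)
                             (edgesOf r)
      children-sorted  : AllPairs _<_ (map proj₂ (edgesOf r))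
      leaves-bounded   : All (λ x → n ≤ x × x < next r) (leavesOf r)
      leaves-sorted    : AllPairs _<_ (leavesOf r)
      leaves-childless : All (λ e → All (proj₁ e ≢_) (leavesOf r)) (edgesOf r)

  record TreeLabelling (s : ℕ) (r : Labelled) : Set where
    field
      size             : next r ≡ suc (length (edgesOf r) + s)
      edges-bounded    : All (λ e → s ≤ proj₁ e × proj₁ e < proj₂ e × proj₂ e < next r) (edgesOf r)
      children-sorted  : AllPairs _<_ (map proj₂ (edgesOf r))
      leaves-bounded   : All (λ x → s ≤ x × x < next r) (leavesOf r)
      leaves-sorted    : AllPairs _<_ (leavesOf r)
      leaves-childless : All (λ e → All (proj₁ e ≢_) (leavesOf r)) (edgesOf r)

  forest⇒tree : ∀ {s r} → ForestLabelling s (suc s) r → TreeLabelling s r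
  forest⇒tree {s} {r} F = record
    { size             = trans F.size (ℕP.+-suc (length (edgesOf r)) s)
    ; edges-bounded    = All.map (λ { (tail , t<h , _ , h<next) →
                                        [ (λ { refl → ℕP.≤-refl }) , ℕP.<⇒≤ ]′ tail , t<h , h<next })
                                 F.edges-bounded
    ; children-sorted  = F.children-sorted
    ; leaves-bounded   = All.map (λ { (s<x , x<next) → ℕP.<⇒≤ s<x , x<next }) F.leaves-bounded
    ; leaves-sorted    = F.leaves-sorted
    ; leaves-childless = F.leaves-childless }
    where module F = ForestLabelling F

  tree-grows : ∀ {s r} → TreeLabelling s r → s < next r
  tree-grows {s} {r} T = subst (s <_) (sym (TreeLabelling.size T)) (s≤s (ℕP.m≤n+m s (length (edgesOf r))))

  forest-grows : ∀ {p n r} → ForestLabelling p n r → n ≤ next r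
  forest-grows {n = n} {r} F = subst (n ≤_) (sym (ForestLabelling.size F)) (ℕP.m≤n+m n (length (edgesOf r)))

  ForestLabelling-∷ : ∀ {p n n₁ e₁ l₁ r} → p < n → TreeLabelling n (n₁ , e₁ , l₁) → ForestLabelling p n₁ r →
                      ForestLabelling p n (next r , (p , n) ∷ e₁ ++ edgesOf r , l₁ ++ leavesOf r)
  ForestLabelling-∷ {p} {n} {n₁} {e₁} {l₁} {n₂ , e₂ , l₂} p<n T F = record
    { size             = trans F.size (trans (cong (length e₂ +_) T.size)
                           (trans (+-suc-+ (length e₁) (length e₂) n) (cong (λ m → suc (m + n)) (sym (LP.length-++ e₁)))))
    ; edges-bounded    = (inj₁ refl , p<n , ℕP.≤-refl , ℕP.<-≤-trans n<n₁ n₁≤n₂) ∷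
                         All.map (λ { (tail , t<h , n<h , h<n₂) → tail , t<h , ℕP.<⇒≤ n<h , h<n₂ })
                                 (AllP.++⁺ treeEdges forestEdges)
    ; children-sorted  = subst (λ hs → AllPairs _<_ (n ∷ hs)) (sym (LP.map-++ proj₂ e₁ e₂))
                               (AllP.++⁺ (AllP.map⁺ (All.map (λ { (_ , _ , n<h , _) → n<h }) treeEdges))
                                         (AllP.map⁺ (All.map (λ { (_ , _ , n<h , _) → n<h }) forestEdges))
                                ∷ AllPairsP.++⁺ T.children-sorted F.children-sorted treeBeforeForest)
    ; leaves-bounded   = AllP.++⁺ (All.map (λ { (n≤x , x<n₁) → n≤x , ℕP.<-≤-trans x<n₁ n₁≤n₂ }) T.leaves-bounded)
                                  (All.map (λ { (n₁≤x , x<n₂) → ℕP.≤-trans n≤n₁ n₁≤x , x<n₂ }) F.leaves-bounded)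
    ; leaves-sorted    = AllPairsP.++⁺ T.leaves-sorted F.leaves-sorted
                           (All.map (λ { (_ , x<n₁) →
                                           All.map (λ { (n₁≤y , _) → ℕP.<-≤-trans x<n₁ n₁≤y }) F.leaves-bounded })
                                    T.leaves-bounded)
    ; leaves-childless = All.map (λ n≤x → ℕP.<⇒≢ (ℕP.<-≤-trans p<n n≤x)) leavesAbove
                         ∷ AllP.++⁺ treeChildless forestChildless
    }
    where
    module T = TreeLabelling T
    module F = ForestLabelling F
    +-suc-+ : ∀ a b n → b + suc (a + n) ≡ suc (a + b + n)
    +-suc-+ = solve-∀
    n<n₁ : n < n₁
    n<n₁ = tree-grows T
    n≤n₁ : n ≤ n₁
    n≤n₁ = ℕP.<⇒≤ n<n₁
    n₁≤n₂ : n₁ ≤ n₂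
    n₁≤n₂ = forest-grows F
    leavesAbove : All (n ≤_) (l₁ ++ l₂)
    leavesAbove = AllP.++⁺ (All.map proj₁ T.leaves-bounded)
                           (All.map (λ { (n₁≤x , _) → ℕP.≤-trans n≤n₁ n₁≤x }) F.leaves-bounded)
    Bounded : Arc → Set
    Bounded e = (proj₁ e ≡ p ⊎ n ≤ proj₁ e) × proj₁ e < proj₂ e × n < proj₂ e × proj₂ e < n₂
    treeEdges : All Bounded e₁
    treeEdges = All.map (λ { (n≤t , t<h , h<n₁) →
                               inj₂ n≤t , t<h , ℕP.≤-<-trans n≤t t<h , ℕP.<-≤-trans h<n₁ n₁≤n₂ })
                        T.edges-bounded
    forestEdges : All Bounded e₂
    forestEdges = All.map (λ { (tail , t<h , n₁≤h , h<n₂) →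
                                 [ inj₁ , (λ n₁≤t → inj₂ (ℕP.≤-trans n≤n₁ n₁≤t)) ]′ tail ,
                                 t<h , ℕP.<-≤-trans n<n₁ n₁≤h , h<n₂ })
                          F.edges-bounded
    treeBeforeForest : All (λ h → All (h <_) (map proj₂ e₂)) (map proj₂ e₁)
    treeBeforeForest = AllP.map⁺ (All.map
      (λ { (_ , _ , h<n₁) → AllP.map⁺ (All.map (λ { (_ , _ , n₁≤h′ , _) → ℕP.<-≤-trans h<n₁ n₁≤h′ }) F.edges-bounded) })
      T.edges-bounded)
    treeChildless : All (λ e → All (proj₁ e ≢_) (l₁ ++ l₂)) e₁
    treeChildless = All.zipWith
      (λ { (childless , (_ , t<h , h<n₁)) →
           AllP.++⁺ childless (All.map (λ { (n₁≤x , _) → ℕP.<⇒≢ (ℕP.<-trans t<h (ℕP.<-≤-trans h<n₁ n₁≤x)) })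
                                       F.leaves-bounded) })
      (T.leaves-childless , T.edges-bounded)
    forestChildless : All (λ e → All (proj₁ e ≢_) (l₁ ++ l₂)) e₂
    forestChildless = All.zipWith
      (λ { (childless , (tail , _)) → AllP.++⁺
           (All.map (λ { (n≤x , x<n₁) → [ (λ { refl → ℕP.<⇒≢ (ℕP.<-≤-trans p<n n≤x) })
                                        , (λ n₁≤t t≡x → ℕP.<⇒≢ (ℕP.<-≤-trans x<n₁ n₁≤t) (sym t≡x)) ]′ tail })
                    T.leaves-bounded)
           childless })
      (F.leaves-childless , F.edges-bounded)

  label-correct  : ∀ t s → TreeLabelling s (label t s)
  labelF-correct : ∀ ts p n → p < n → ForestLabelling p n (labelF ts p n)
  label-correct (node []) s = record
    { size = refl ; edges-bounded = [] ; children-sorted = []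
    ; leaves-bounded = (ℕP.≤-refl , ℕP.n<1+n s) ∷ [] ; leaves-sorted = [] ∷ [] ; leaves-childless = [] }
  label-correct (node (c ∷ cs)) s = forest⇒tree (labelF-correct (c ∷ cs) s (suc s) (ℕP.n<1+n s))
  labelF-correct [] p n p<n = record
    { size = refl ; edges-bounded = [] ; children-sorted = [] ; leaves-bounded = [] ; leaves-sorted = []
    ; leaves-childless = [] }
  labelF-correct (t ∷ ts) p n p<n with label t n | label-correct t n
  ... | (n₁ , e₁ , l₁) | T = ForestLabelling-∷ p<n T (labelF-correct ts p n₁ (ℕP.<-trans p<n (tree-grows T)))

module LeafFans where

  open EulerSum using (Arc)
  open Paths using (consecutive)
  open Labelling
  open import Data.Nat as ℕ using (ℕ; suc; _+_; _<_; _≤_; z≤n; s≤s; _≟_)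
  import Data.Nat.Properties as ℕP
  open import Data.List using (List; []; _∷_; _++_; map; length; filter)
  import Data.List.Properties as LP
  open import Data.List.Relation.Unary.All as All using (All; []; _∷_)
  import Data.List.Relation.Unary.All.Properties as AllP
  open import Data.List.Relation.Unary.Any using (Any; here; there)
  open import Data.Product using (_,_; proj₁; Σ)
  open import Data.Sum using (_⊎_; inj₁; inj₂; [_,_]′)
  open import Relation.Binary.PropositionalEquality
  open import Relation.Nullary using (¬_)
  open import Data.Empty using (⊥-elim)

  edgesFrom : ℕ → List Arc → List Arc
  edgesFrom P = filter (λ e → proj₁ e ≟ P)

  edgesFrom-++ : ∀ P E E′ → edgesFrom P (E ++ E′) ≡ edgesFrom P E ++ edgesFrom P E′
  edgesFrom-++ P = LP.filter-++ (λ e → proj₁ e ≟ P)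

  edgesFrom-none : ∀ {P} E → All (λ e → proj₁ e ≢ P) E → edgesFrom P E ≡ []
  edgesFrom-none {P} E = LP.filter-none (λ e → proj₁ e ≟ P)

  edgesFrom-∷-other : ∀ {P} e E → proj₁ e ≢ P → edgesFrom P (e ∷ E) ≡ edgesFrom P E
  edgesFrom-∷-other {P} e E = LP.filter-reject (λ e → proj₁ e ≟ P) {e} {E}

  edgesFrom-star : ∀ P xs → edgesFrom P (map (P ,_) xs) ≡ map (P ,_) xs
  edgesFrom-star P xs = LP.filter-all (λ e → proj₁ e ≟ P) (AllP.map⁺ (All.universal (λ _ → refl) xs))

  -- a vertex P ≥ lo whose children are k ≥ 2 leaves, necessarily numbered P+1, …, P+k
  record LeafFan (lo : ℕ) (r : Labelled) : Set where
    field
      P k           : ℕ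
      before after  : List ℕ
      2≤k           : 2 ≤ k
      lo≤P          : lo ≤ P
      P<next        : P < next r
      edgesFrom-P   : edgesFrom P (edgesOf r) ≡ map (P ,_) (consecutive (suc P) k)
      leaves≡       : leavesOf r ≡ before ++ consecutive (suc P) k ++ after

  -- every subtree of the forest other than the one containing the fan contributes a leaf
  LeafFanIn : ℕ → List Tree → Labelled → Set
  LeafFanIn lo ts r = Σ (LeafFan lo r) λ F → length ts ≤ suc (length (LeafFan.before F) + length (LeafFan.after F))

  labelF-allLeaves : ∀ ts p n → All IsLeaf ts →
    labelF ts p n ≡ (length ts + n , map (p ,_) (consecutive n (length ts)) , consecutive n (length ts))
  labelF-allLeaves []            p n []           = refl
  labelF-allLeaves (node [] ∷ ts) p n (refl ∷ ls) rewrite labelF-allLeaves ts p (suc n) ls =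
    cong (λ size → size , (p , n) ∷ map (p ,_) (consecutive (suc n) (length ts)) , n ∷ consecutive (suc n) (length ts))
         (ℕP.+-suc (length ts) n)

  allLeaves⊎inner : ∀ ts → All IsLeaf ts ⊎ Any (λ t → ¬ IsLeaf t) ts
  allLeaves⊎inner []                  = inj₁ []
  allLeaves⊎inner (node (_ ∷ _) ∷ ts) = inj₂ (here λ ())
  allLeaves⊎inner (node [] ∷ ts) with allLeaves⊎inner ts
  ... | inj₁ leaves = inj₁ (refl ∷ leaves)
  ... | inj₂ inner  = inj₂ (there inner)

  LeafFan-weaken : ∀ {lo lo′ r} → lo′ ≤ lo → LeafFan lo r → LeafFan lo′ r
  LeafFan-weaken lo′≤lo F = record
    { P = P ; k = k ; before = before ; after = after ; 2≤k = 2≤k ; lo≤P = ℕP.≤-trans lo′≤lo lo≤P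
    ; P<next = P<next ; edgesFrom-P = edgesFrom-P ; leaves≡ = leaves≡ }
    where open LeafFan F

  leafFan-star : ∀ ts s → 2 ≤ length ts → All IsLeaf ts → LeafFan s (label (node ts) s)
  leafFan-star []       s ()          _
  leafFan-star (_ ∷ []) s (s≤s ())    _
  leafFan-star ts@(_ ∷ _ ∷ _) s 2≤k leaves rewrite labelF-allLeaves ts s (suc s) leaves = record
    { P = s ; k = length ts ; before = [] ; after = [] ; 2≤k = 2≤k ; lo≤P = ℕP.≤-refl
    ; P<next = ℕP.<-≤-trans (ℕP.n<1+n s) (ℕP.m≤n+m (suc s) (length ts))
    ; edgesFrom-P = edgesFrom-star s (consecutive (suc s) (length ts))
    ; leaves≡ = sym (LP.++-identityʳ _) }

  leafCount-tree   : ∀ t s → 1 ≤ length (leavesOf (label t s))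
  leafCount-forest : ∀ ts p n → length ts ≤ length (leavesOf (labelF ts p n))
  leafCount-tree (node [])       s = s≤s z≤n
  leafCount-tree (node (c ∷ cs)) s = ℕP.≤-trans (s≤s z≤n) (leafCount-forest (c ∷ cs) s (suc s))
  leafCount-forest []       p n = z≤n
  leafCount-forest (t ∷ ts) p n with label t n | leafCount-tree t n
  ... | (n₁ , e₁ , l₁) | 1≤l₁ with labelF ts p n₁ | leafCount-forest ts p n₁
  ... | (n₂ , e₂ , l₂) | ts≤l₂ = subst (suc (length ts) ≤_) (sym (LP.length-++ l₁)) (ℕP.+-mono-≤ 1≤l₁ ts≤l₂)

  leafFan-head : ∀ t ts p n → p < n → LeafFan n (label t n) → LeafFanIn n (t ∷ ts) (labelF (t ∷ ts) p n)
  leafFan-head t ts p n p<n F₁ with label t n | F₁ | label-correct t n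
  ... | (n₁ , e₁ , l₁) | F | T with labelF ts p n₁ | labelF-correct ts p n₁ (ℕP.<-trans p<n (tree-grows T))
                                 | leafCount-forest ts p n₁
  ... | (n₂ , e₂ , l₂) | R | ts≤l₂ = record
    { P = P ; k = k ; before = before ; after = after ++ l₂ ; 2≤k = 2≤k ; lo≤P = lo≤P
    ; P<next = ℕP.<-≤-trans P<next (forest-grows R)
    ; edgesFrom-P = begin
        edgesFrom P ((p , n) ∷ e₁ ++ e₂)         ≡⟨ edgesFrom-∷-other (p , n) (e₁ ++ e₂) (ℕP.<⇒≢ p<P) ⟩
        edgesFrom P (e₁ ++ e₂)                   ≡⟨ edgesFrom-++ P e₁ e₂ ⟩
        edgesFrom P e₁ ++ edgesFrom P e₂         ≡⟨ cong₂ _++_ edgesFrom-P (edgesFrom-none e₂ notFromP) ⟩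
        map (P ,_) (consecutive (suc P) k) ++ [] ≡⟨ LP.++-identityʳ _ ⟩
        map (P ,_) (consecutive (suc P) k)       ∎
    ; leaves≡ = trans (cong (_++ l₂) leaves≡)
                  (trans (LP.++-assoc before _ l₂) (cong (before ++_) (LP.++-assoc (consecutive (suc P) k) after l₂)))
    } , s≤s (ℕP.≤-trans ts≤l₂ (ℕP.≤-trans (ℕP.m≤n+m (length l₂) (length before + length after))
              (ℕP.≤-reflexive (trans (ℕP.+-assoc (length before) _ _)
                                     (cong (length before +_) (sym (LP.length-++ after)))))))
    where
    open LeafFan F
    open ≡-Reasoning
    p<P : p < P
    p<P = ℕP.<-≤-trans p<n lo≤P
    notFromP : All (λ e → proj₁ e ≢ P) e₂
    notFromP = All.map (λ { (tail , _) → [ (λ { refl → ℕP.<⇒≢ p<P })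
                                         , (λ n₁≤t t≡P → ℕP.<⇒≢ (ℕP.<-≤-trans P<next n₁≤t) (sym t≡P)) ]′ tail })
                       (ForestLabelling.edges-bounded R)

  leafFan-tail : ∀ t ts p n → p < n → LeafFanIn (next (label t n)) ts (labelF ts p (next (label t n))) →
                 LeafFanIn n (t ∷ ts) (labelF (t ∷ ts) p n)
  leafFan-tail t ts p n p<n F₂ with label t n | label-correct t n | leafCount-tree t n | F₂
  ... | (n₁ , e₁ , l₁) | T | 1≤l₁ | (F , ts≤rest) with labelF ts p n₁
  ... | (n₂ , e₂ , l₂) = record
    { P = P ; k = k ; before = l₁ ++ before ; after = after ; 2≤k = 2≤k
    ; lo≤P = n≤P
    ; P<next = P<next
    ; edgesFrom-P = trans (edgesFrom-∷-other (p , n) (e₁ ++ e₂) (ℕP.<⇒≢ (ℕP.<-≤-trans p<n n≤P)))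
                      (trans (edgesFrom-++ P e₁ e₂) (trans (cong (_++ _) (edgesFrom-none e₁ notFromP)) edgesFrom-P))
    ; leaves≡ = trans (cong (l₁ ++_) leaves≡) (sym (LP.++-assoc l₁ before _))
    } , s≤s (ℕP.≤-trans ts≤rest (ℕP.≤-trans (ℕP.+-monoˡ-≤ (length before + length after) 1≤l₁)
              (ℕP.≤-reflexive (trans (sym (ℕP.+-assoc (length l₁) _ _))
                                     (cong (_+ length after) (sym (LP.length-++ l₁)))))))
    where
    open LeafFan F
    n≤P : n ≤ P
    n≤P = ℕP.≤-trans (ℕP.<⇒≤ (tree-grows T)) lo≤P
    notFromP : All (λ e → proj₁ e ≢ P) e₁
    notFromP = All.map (λ { (_ , t<h , h<n₁) → ℕP.<⇒≢ (ℕP.<-≤-trans (ℕP.<-trans t<h h<n₁) lo≤P) })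
                       (TreeLabelling.edges-bounded T)

  -- the fan below is passed in, keeping the recursion of leafFan-forest structural
  leafFan-node : ∀ us s → 2 ≤ length us → All IsLeaf us ⊎ Any (λ t → ¬ IsLeaf t) us →
                 (Any (λ t → ¬ IsLeaf t) us → LeafFan (suc s) (labelF us s (suc s))) → LeafFan s (label (node us) s)
  leafFan-node us             s 2≤k      (inj₁ leaves) _        = leafFan-star us s 2≤k leaves
  leafFan-node (_ ∷ [])       s (s≤s ()) (inj₂ _)      _
  leafFan-node us@(_ ∷ _ ∷ _) s 2≤k      (inj₂ inner)  fanBelow = LeafFan-weaken (ℕP.n≤1+n s) (fanBelow inner)

  leafFan-forest : ∀ ts p n → p < n → NoDeg2F ts → Any (λ t → ¬ IsLeaf t) ts → LeafFanIn n ts (labelF ts p n)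
  leafFan-forest (node [] ∷ ts)             p n p<n _                  (here notLeaf) = ⊥-elim (notLeaf refl)
  leafFan-forest (node (_ ∷ []) ∷ ts)       p n p<n ((≢1 , _) , _)     (here _)       = ⊥-elim (≢1 refl)
  leafFan-forest (node us@(_ ∷ _ ∷ _) ∷ ts) p n p<n ((_ , noDeg2) , _) (here _) =
    leafFan-head (node us) ts p n p<n
      (leafFan-node us n (s≤s (s≤s z≤n)) (allLeaves⊎inner us)
        (λ inner → proj₁ (leafFan-forest us n (suc n) (ℕP.n<1+n n) noDeg2 inner)))
  leafFan-forest (t ∷ ts) p n p<n (_ , noDeg2) (there inner) =
    leafFan-tail t ts p n p<n
      (leafFan-forest ts p (next (label t n)) (ℕP.<-trans p<n (tree-grows (label-correct t n))) noDeg2 inner)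

module HalinFan where

  open EulerSum
  open Fans
  open Paths
  open ListProperties
  open Orientations using (orient-map)
  open LeafFans using (edgesFrom)
  open Occurrences
  open EulerianCount using (eulerSum≡1⇒AlonTarsi; -1^-isEven)
  open import Data.Vec as Vec using (Vec)
  import Data.Vec.Properties as VecP
  open import Data.Nat as ℕ using (ℕ; zero; suc; _+_; _<_; _≤_; z≤n; s≤s; _%_; _≟_; _≤?_)
  import Data.Nat.Properties as ℕP
  open import Data.Bool using (Bool; if_then_else_)
  open import Data.List using (List; []; _∷_; _++_; [_]; length; map; filter; reverse)
  import Data.List.Properties as LP
  open import Data.List.Relation.Binary.Permutation.Propositional using (_↭_; ↭-sym; ↭-trans; ↭-prep; ↭-reflexive)
  import Data.List.Relation.Binary.Permutation.Propositional.Properties as ↭P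
  open import Data.List.Relation.Binary.Permutation.Propositional using (↭⇒↭ₛ)
  import Data.List.Relation.Binary.Permutation.Setoid.Properties
  open import Relation.Nullary using (¬_; Dec; does; yes; no; ¬?; _×-dec_)
  open import Relation.Nullary.Decidable using (dec-true; dec-false)
  open import Relation.Binary.Definitions using (tri<; tri≈; tri>)
  open import Function using (_∘_; id)
  open import Data.List.Membership.Propositional using (_∈_)
  open import Data.List.Relation.Unary.All as All using (All; []; _∷_)
  import Data.List.Relation.Unary.All.Properties as AllP
  open import Data.List.Relation.Unary.AllPairs as AllPairs using (AllPairs; []; _∷_)
  import Data.List.Relation.Unary.AllPairs.Properties as AllPairsP
  open import Data.Product using (_×_; _,_; proj₁; proj₂; ∃; swap)
  import Data.Sum as Sum
  open Sum using (_⊎_; inj₁; inj₂)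
  open import Data.Integer as ℤ using (0ℤ; 1ℤ; -1ℤ)
  import Data.Integer.Properties as ℤP
  open import Relation.Binary.PropositionalEquality hiding ([_])

  module ↭ₛP = Data.List.Relation.Binary.Permutation.Setoid.Properties (setoid ℕ)

  -- the labelled Halin graph (tree edges E, leaves L in cyclic order, vertices 0 … N−1) together
  -- with a vertex P whose children are exactly the leaves P+1, …, P+k
  record LabelledHalin : Set where
    field
      N                : ℕ
      E                : List Arc
      L                : List ℕ
      P k              : ℕ
      before after     : List ℕ
      2≤k              : 2 ≤ k
      size             : N ≡ suc (length E)
      edges-bounded    : All (λ e → proj₁ e < proj₂ e × proj₂ e < N) E
      children-sorted  : AllPairs _<_ (map proj₂ E)
      leaves-bounded   : All (_< N) L
      leaves-sorted    : AllPairs _<_ L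
      leaves-childless : All (λ e → All (proj₁ e ≢_) L) E
      edgesFrom-P      : edgesFrom P E ≡ map (P ,_) (consecutive (suc P) k)
      leaves≡          : L ≡ before ++ consecutive (suc P) k ++ after
      2≤others         : 2 ≤ length before + length after
      odd              : length L % 2 ≡ 1

  OutsideBlock : ℕ → ℕ → ℕ → Set
  OutsideBlock P k x = x < suc P ⊎ P + k < x

  module Geometry (H : LabelledHalin) where
    open LabelledHalin H public

    block : List ℕ
    block = consecutive (suc P) k

    rest : List ℕ
    rest = after ++ before

    k-1 : ∃ λ j → k ≡ suc j × 1 ≤ j
    k-1 with k | 2≤k
    ... | suc (suc j) | _        = suc j , refl , s≤s z≤n
    ... | suc zero    | s≤s ()

    j : ℕ
    j = proj₁ k-1

    k≡1+j : k ≡ suc j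
    k≡1+j = proj₁ (proj₂ k-1)

    1≤j : 1 ≤ j
    1≤j = proj₂ (proj₂ k-1)

    j-1 : ∃ λ j′ → j ≡ suc j′
    j-1 with j | 1≤j
    ... | suc j′ | _ = j′ , refl

    1+P+j≡P+k : suc P + j ≡ P + k
    1+P+j≡P+k = trans (sym (ℕP.+-suc P j)) (cong (P +_) (sym k≡1+j))

    block≡∷ : block ≡ suc P ∷ consecutive (suc (suc P)) j
    block≡∷ = cong (consecutive (suc P)) k≡1+j

    block≡∷ʳ : block ≡ consecutive (suc P) j ++ [ P + k ]
    block≡∷ʳ = trans block≡∷ (trans (consecutive-∷ʳ (suc P) j) (cong (λ z → consecutive (suc P) j ++ [ z ]) 1+P+j≡P+k))

    1+P≤P+k : suc P ≤ P + k
    1+P≤P+k = subst (_≤ P + k) (ℕP.+-comm P 1) (ℕP.+-monoʳ-≤ P (ℕP.≤-trans (s≤s z≤n) 2≤k))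

    ∈-block : ∀ {x} → suc P ≤ x → x ≤ P + k → x ∈ block
    ∈-block 1+P≤x x≤P+k = ∈-consecutive 1+P≤x (s≤s x≤P+k)

    block-bounds : All (λ x → suc P ≤ x × x ≤ P + k) block
    block-bounds = All.map (λ { (1+P≤x , x<1+P+k) → 1+P≤x , ℕP.≤-pred x<1+P+k }) (consecutive-bounds (suc P) k)

    inBlock≢outside : ∀ {x v} → suc P ≤ x → x ≤ P + k → OutsideBlock P k v → x ≢ v
    inBlock≢outside 1+P≤x x≤P+k (inj₁ v<1+P) x≡v = ℕP.<⇒≢ (ℕP.<-≤-trans v<1+P 1+P≤x) (sym x≡v)
    inBlock≢outside 1+P≤x x≤P+k (inj₂ P+k<v) x≡v = ℕP.<⇒≢ (ℕP.≤-<-trans x≤P+k P+k<v) x≡v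

    private
      sorted : AllPairs _<_ (before ++ block ++ after)
      sorted = subst (AllPairs _<_) leaves≡ leaves-sorted
      splitBefore : AllPairs _<_ before × AllPairs _<_ (block ++ after) × All (λ x → All (x <_) (block ++ after)) before
      splitBefore = AllPairs-++⁻ before sorted
      splitAfter : AllPairs _<_ block × AllPairs _<_ after × All (λ x → All (x <_) after) block
      splitAfter = AllPairs-++⁻ block (proj₁ (proj₂ splitBefore))

    before<block : All (_< suc P) before
    before<block = All.map (λ below → All.head (subst (λ z → All (_ <_) (z ++ after)) block≡∷ below))
                           (proj₂ (proj₂ splitBefore))

    block<after : All (P + k <_) after
    block<after = All.head (AllP.++⁻ʳ (consecutive (suc P) j)
                             (subst (All (λ x → All (x <_) after)) block≡∷ʳ (proj₂ (proj₂ splitAfter))))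

    rest-outside : All (OutsideBlock P k) rest
    rest-outside = AllP.++⁺ (All.map inj₂ block<after) (All.map inj₁ before<block)

    rest-distinct : AllPairs _≢_ rest
    rest-distinct = AllPairsP.++⁺ (AllPairs.map ℕP.<⇒≢ (proj₁ (proj₂ splitAfter)))
                                  (AllPairs.map ℕP.<⇒≢ (proj₁ splitBefore))
      (All.map (λ P+k<x → All.map (λ y<1+P x≡y →
                                     ℕP.<⇒≢ (ℕP.<-≤-trans y<1+P (ℕP.≤-trans (s≤s (ℕP.m≤m+n P k)) P+k<x)) (sym x≡y))
                                  before<block)
               block<after)

    private
      leaves∈ : All (_∈ L) before × All (_∈ L) (block ++ after)
      leaves∈ = AllP.++⁻ before (subst (All (_∈ L)) leaves≡ (All.tabulate (λ x∈L → x∈L)))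

    block⊆L : All (_∈ L) block
    block⊆L = proj₁ (AllP.++⁻ block (proj₂ leaves∈))

    rest⊆L : All (_∈ L) rest
    rest⊆L = AllP.++⁺ (proj₂ (AllP.++⁻ block (proj₂ leaves∈))) (proj₁ leaves∈)

    P∉L : All (P ≢_) L
    P∉L = All.head (subst (All (λ e → All (proj₁ e ≢_) L))
                          (trans edgesFrom-P (cong (map (P ,_)) block≡∷))
                          (AllP.filter⁺ (λ e → proj₁ e ℕ.≟ P) leaves-childless))

    2≤|rest| : 2 ≤ length rest
    2≤|rest| = subst (2 ≤_) (trans (ℕP.+-comm (length before) (length after)) (sym (LP.length-++ after))) 2≤others

    -- the outer cycle read from P+1: the leaves P+1, …, P+m, then y, then the leaves ws
    record CycleSplit : Set where
      field
        m y         : ℕ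
        ws          : List ℕ
        1≤m         : 1 ≤ m
        m≤k         : m ≤ k
        splits      : block ++ rest ≡ consecutive (suc P) m ++ y ∷ ws
        y-outside   : y < suc P ⊎ P + m < y
        ws-outside  : All (OutsideBlock P k) ws
        ws-distinct : AllPairs _≢_ ws
        ws⊆L        : All (_∈ L) ws
        y∈L         : y ∈ L
        ws≢y        : All (_≢ y) ws

  inPrefix? : (P m x : ℕ) → Dec (suc P ≤ x × x ≤ P + m)
  inPrefix? P m x = suc P ≤? x ×-dec x ≤? P + m

  -- Tree edges (parent, child) are turned towards the root, except P → P+1; a cycle edge keeps
  -- its direction exactly when it leaves one of P+1, …, P+m.
  keep : ℕ → ℕ → Arc → Bool
  keep P m e = if does (proj₁ e ≟ P) then does (proj₂ e ≟ suc P) else does (inPrefix? P m (proj₁ e))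

  oriented : ℕ → ℕ → Arc → Arc
  oriented P m e = if keep P m e then e else swap e

  oriented-P→1+P : ∀ P m → oriented P m (P , suc P) ≡ (P , suc P)
  oriented-P→1+P P m rewrite dec-true (P ≟ P) refl = refl

  oriented-spoke : ∀ P m {x} → x ≢ suc P → oriented P m (P , x) ≡ (x , P)
  oriented-spoke P m {x} x≢1+P rewrite dec-true (P ≟ P) refl | dec-false (x ≟ suc P) x≢1+P = refl

  oriented-inPrefix : ∀ P m e → proj₁ e ≢ P → suc P ≤ proj₁ e → proj₁ e ≤ P + m → oriented P m e ≡ e
  oriented-inPrefix P m e t≢P 1+P≤t t≤P+m
    rewrite dec-false (proj₁ e ≟ P) t≢P | dec-true (inPrefix? P m (proj₁ e)) (1+P≤t , t≤P+m) = refl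

  oriented-outsidePrefix : ∀ P m e → proj₁ e ≢ P → ¬ (suc P ≤ proj₁ e × proj₁ e ≤ P + m) → oriented P m e ≡ swap e
  oriented-outsidePrefix P m e t≢P ∉prefix
    rewrite dec-false (proj₁ e ≟ P) t≢P | dec-false (inPrefix? P m (proj₁ e)) ∉prefix = refl

  module Oriented (H : LabelledHalin) (S : Geometry.CycleSplit H) where
    open Geometry H
    open CycleSplit S

    otherEdges : List Arc
    otherEdges = filter (λ e → ¬? (proj₁ e ≟ P)) E

    E↭ : E ↭ otherEdges ++ map (P ,_) block
    E↭ = subst (λ es → E ↭ otherEdges ++ es) edgesFrom-P (↭-filter-partition (λ e → proj₁ e ≟ P) E)

    prefix spokes : List ℕ
    prefix = consecutive (suc P) m
    spokes = consecutive (suc (suc P)) j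

    fanArcs : List Arc
    fanArcs = (P , suc P) ∷ map (_, P) spokes

    forward back : List Arc
    forward = path (prefix ++ [ y ])
    back    = path (y ∷ ws ++ [ suc P ])

    core : List Arc
    core = fanArcs ++ forward ++ map swap back

    arcs : List Arc
    arcs = orient (E ++ cycleEdges L) (map (keep P m) (E ++ cycleEdges L))

    P+m≤P+k : P + m ≤ P + k
    P+m≤P+k = ℕP.+-monoʳ-≤ P m≤k

    prefix-bounds : All (λ x → suc P ≤ x × x ≤ P + k) prefix
    prefix-bounds = All.map (λ { (1+P≤x , x<1+P+m) → 1+P≤x , ℕP.≤-trans (ℕP.≤-pred x<1+P+m) P+m≤P+k })
                            (consecutive-bounds (suc P) m)

    spokes-bounds : All (λ x → suc P ≤ x × x ≤ P + k) spokes
    spokes-bounds = All.map (λ { {x} (2+P≤x , x<2+P+j) →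
                                   ℕP.<⇒≤ 2+P≤x , ℕP.≤-pred (subst (x <_) (cong suc 1+P+j≡P+k) x<2+P+j) })
                            (consecutive-bounds (suc (suc P)) j)

    outside⇒∉prefix : ∀ {x} → x < suc P ⊎ P + m < x → ¬ (suc P ≤ x × x ≤ P + m)
    outside⇒∉prefix (inj₁ x<1+P) (1+P≤x , _)   = ℕP.<-irrefl refl (ℕP.<-≤-trans x<1+P 1+P≤x)
    outside⇒∉prefix (inj₂ P+m<x) (_ , x≤P+m)   = ℕP.<-irrefl refl (ℕP.<-≤-trans P+m<x x≤P+m)

    L∌P : ∀ {x} → x ∈ L → x ≢ P
    L∌P x∈L x≡P = All.lookup P∉L x∈L (sym x≡P)

    prefix′ : ∃ λ m′ → prefix ≡ suc P ∷ consecutive (suc (suc P)) m′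
    prefix′ with m | 1≤m
    ... | suc m′ | _ = m′ , refl

    cycle↭ : cycleEdges L ↭ forward ++ back
    cycle↭ = subst₂ _↭_ (sym (trans (cycleEdges≡cycle L) (cong cycle leaves≡)))
                        (trans (cong cycle (LP.++-assoc block after before)) split)
                        (cycle-rotate before (block ++ after))
      where
      tail′ : prefix ≡ suc P ∷ consecutive (suc (suc P)) (proj₁ prefix′)
      tail′ = proj₂ prefix′
      split : cycle (block ++ rest) ≡ forward ++ back
      split = begin
          cycle (block ++ rest)
        ≡⟨ cong cycle (trans splits (cong (_++ y ∷ ws) tail′)) ⟩
          path (suc P ∷ (consecutive (suc (suc P)) (proj₁ prefix′) ++ y ∷ ws) ++ [ suc P ])
        ≡⟨ cong (λ z → path (suc P ∷ z)) (LP.++-assoc (consecutive (suc (suc P)) (proj₁ prefix′)) (y ∷ ws) [ suc P ]) ⟩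
          path ((suc P ∷ consecutive (suc (suc P)) (proj₁ prefix′)) ++ y ∷ (ws ++ [ suc P ]))
        ≡⟨ path-++ (suc P ∷ consecutive (suc (suc P)) (proj₁ prefix′)) y (ws ++ [ suc P ]) ⟩
          path ((suc P ∷ consecutive (suc (suc P)) (proj₁ prefix′)) ++ [ y ]) ++ back
        ≡⟨ cong (λ z → path (z ++ [ y ]) ++ back) (sym tail′) ⟩
          forward ++ back
        ∎
        where open ≡-Reasoning

    oriented-fan : map (oriented P m) (map (P ,_) block) ≡ fanArcs
    oriented-fan = trans (cong (λ xs → map (oriented P m) (map (P ,_) xs)) block≡∷)
      (cong₂ _∷_ (oriented-P→1+P P m)
                 (trans (sym (LP.map-∘ spokes))
                        (LP.map-cong-local (All.map (λ { (2+P≤x , _) → oriented-spoke P m (≢-sym (ℕP.<⇒≢ 2+P≤x)) })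
                                                    (consecutive-bounds (suc (suc P)) j)))))

    oriented-otherEdges : map (oriented P m) otherEdges ≡ map swap otherEdges
    oriented-otherEdges = LP.map-cong-local (All.zipWith
      (λ { {e} (t≢P , childless) → oriented-outsidePrefix P m e t≢P
             (λ { (1+P≤t , t≤P+m) →
                  All.lookup childless (All.lookup block⊆L (∈-block 1+P≤t (ℕP.≤-trans t≤P+m P+m≤P+k))) refl }) })
      (AllP.all-filter (λ e → ¬? (proj₁ e ≟ P)) E , AllP.filter⁺ (λ e → ¬? (proj₁ e ≟ P)) leaves-childless))

    oriented-forward : map (oriented P m) forward ≡ forward
    oriented-forward = trans (LP.map-cong-local (All.map
      (λ { {e} (1+P≤t , t<1+P+m) → oriented-inPrefix P m e (≢-sym (ℕP.<⇒≢ 1+P≤t)) 1+P≤t (ℕP.≤-pred t<1+P+m) })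
      (All-proj₁-path y (consecutive-bounds (suc P) m)))) (LP.map-id forward)

    oriented-back : map (oriented P m) back ≡ map swap back
    oriented-back = LP.map-cong-local (All.map
      (λ { {e} (t≢P , outside) → oriented-outsidePrefix P m e t≢P (outside⇒∉prefix outside) })
      (All-proj₁-path (suc P) ((L∌P y∈L , y-outside) ∷
         All.zipWith (λ { (outside , w∈L) → L∌P w∈L , Sum.map₂ (ℕP.≤-<-trans P+m≤P+k) outside })
                     (ws-outside , ws⊆L))))

    arcs↭ : arcs ↭ map swap otherEdges ++ core
    arcs↭ = subst (_↭ map swap otherEdges ++ core)
      (sym (trans (orient-map (keep P m) (E ++ cycleEdges L)) (LP.map-++ (oriented P m) E (cycleEdges L))))
      (↭-trans (↭P.++⁺ (↭P.map⁺ (oriented P m) E↭) (↭P.map⁺ (oriented P m) cycle↭))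
        (subst₂ (λ es cs → es ++ cs ↭ map swap otherEdges ++ core)
           (sym (trans (LP.map-++ (oriented P m) otherEdges (map (P ,_) block)) (cong₂ _++_ oriented-otherEdges oriented-fan)))
           (sym (trans (LP.map-++ (oriented P m) forward back) (cong₂ _++_ oriented-forward oriented-back)))
           (↭-reflexive (LP.++-assoc (map swap otherEdges) fanArcs (forward ++ map swap back)))))

    coreTails tails : List ℕ
    coreTails = (P ∷ spokes) ++ prefix ++ ws ++ [ suc P ]
    tails     = map proj₂ otherEdges ++ coreTails

    map-proj₁-core : map proj₁ core ≡ coreTails
    map-proj₁-core = begin
        map proj₁ core
      ≡⟨ LP.map-++ proj₁ fanArcs _ ⟩
        map proj₁ fanArcs ++ map proj₁ (forward ++ map swap back)
      ≡⟨ cong (λ z → P ∷ z ++ map proj₁ (forward ++ map swap back)) (trans (sym (LP.map-∘ spokes)) (LP.map-id spokes)) ⟩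
        (P ∷ spokes) ++ map proj₁ (forward ++ map swap back)
      ≡⟨ cong ((P ∷ spokes) ++_)
              (trans (LP.map-++ proj₁ forward (map swap back))
                     (cong₂ _++_ forwardTails (trans (sym (LP.map-∘ back)) (map-proj₂-path y (ws ++ [ suc P ]))))) ⟩
        coreTails
      ∎
      where
      open ≡-Reasoning
      forwardTails : map proj₁ forward ≡ prefix
      forwardTails = trans (cong (λ z → map proj₁ (path (z ++ [ y ]))) (proj₂ prefix′))
                           (trans (map-proj₁-path (suc P) _ y) (sym (proj₂ prefix′)))

    map-proj₁-arcs : map proj₁ (map swap otherEdges ++ core) ≡ tails
    map-proj₁-arcs = trans (LP.map-++ proj₁ (map swap otherEdges) core)
                           (cong₂ _++_ (sym (LP.map-∘ otherEdges)) map-proj₁-core)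

    outdeg≡occurrences-tails : ∀ v → outdeg v arcs ≡ occurrences v tails
    outdeg≡occurrences-tails v = trans (outdeg≡occurrences v arcs)
      (trans (occurrences-↭ v (↭P.map⁺ proj₁ arcs↭)) (cong (occurrences v) map-proj₁-arcs))

    children-distinct : AllPairs _≢_ (map proj₂ E)
    children-distinct = AllPairs.map ℕP.<⇒≢ children-sorted

    childOccurrences≤1 : ∀ v → occurrences v (map proj₂ otherEdges) ≤ 1
    childOccurrences≤1 v =
      occurrences-distinct v
        (AllPairsP.map⁺ (AllPairsP.filter⁺ (λ e → ¬? (proj₁ e ≟ P)) (AllPairsP.map⁻ children-distinct)))

    -- the block vertices are already children of P
    childOccurrences-block : ∀ {v} → v ∈ block → occurrences v (map proj₂ otherEdges) ≡ 0
    childOccurrences-block {v} v∈block = ℕP.n≤0⇒n≡0 (ℕP.+-cancelʳ-≤ 1 _ 0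
      (ℕP.≤-trans (ℕP.+-monoʳ-≤ (occurrences v (map proj₂ otherEdges)) (occurrences-present v∈block)) total≤1))
      where
      total≤1 : occurrences v (map proj₂ otherEdges) + occurrences v block ≤ 1
      total≤1 = subst (_≤ 1)
        (trans (occurrences-↭ v (↭P.map⁺ proj₂ E↭))
          (trans (cong (occurrences v) (LP.map-++ proj₂ otherEdges (map (P ,_) block)))
            (trans (occurrences-++ v (map proj₂ otherEdges) _)
                   (cong (λ xs → occurrences v (map proj₂ otherEdges) + occurrences v xs)
                         (trans (sym (LP.map-∘ block)) (LP.map-id block))))))
        (occurrences-distinct v children-distinct)

    private
      absent : ∀ {v xs} → All (_≢ v) xs → occurrences v xs ≤ 0
      absent ≢v = ℕP.≤-reflexive (occurrences-absent ≢v)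


    occurrencesByPart : ℕ → ℕ
    occurrencesByPart v = occurrences v (map proj₂ otherEdges) +
      ((occurrences v [ P ] + occurrences v spokes) + (occurrences v prefix + (occurrences v ws + occurrences v [ suc P ])))

    occurrencesByPart≤ : ∀ v {A B C D E F} → occurrences v (map proj₂ otherEdges) ≤ A → occurrences v [ P ] ≤ B →
      occurrences v spokes ≤ C → occurrences v prefix ≤ D → occurrences v ws ≤ E → occurrences v [ suc P ] ≤ F →
      occurrencesByPart v ≤ A + ((B + C) + (D + (E + F)))
    occurrencesByPart≤ v a b c d e f =
      ℕP.+-mono-≤ a (ℕP.+-mono-≤ (ℕP.+-mono-≤ b c) (ℕP.+-mono-≤ d (ℕP.+-mono-≤ e f)))

    occurrences-tails : ∀ v → occurrences v tails ≡ occurrencesByPart v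
    occurrences-tails v =
      trans (occurrences-++ v (map proj₂ otherEdges) _) (cong (occurrences v (map proj₂ otherEdges) +_)
        (trans (occurrences-++ v (P ∷ spokes) _) (cong₂ _+_ (occurrences-++ v [ P ] spokes)
          (trans (occurrences-++ v prefix _) (cong (occurrences v prefix +_) (occurrences-++ v ws [ suc P ]))))))

    occurrencesByPart-outside : ∀ v → OutsideBlock P k v → v ≢ P → occurrencesByPart v ≤ 2
    occurrencesByPart-outside v outside v≢P = occurrencesByPart≤ v
      (childOccurrences≤1 v)
      (absent (≢-sym v≢P ∷ []))
      (absent (All.map (λ { (1+P≤x , x≤P+k) → inBlock≢outside 1+P≤x x≤P+k outside }) spokes-bounds))
      (absent (All.map (λ { (1+P≤x , x≤P+k) → inBlock≢outside 1+P≤x x≤P+k outside }) prefix-bounds))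
      (occurrences-distinct v ws-distinct)
      (absent (inBlock≢outside ℕP.≤-refl 1+P≤P+k outside ∷ []))

    outdeg≤2 : ∀ v → outdeg v arcs ≤ 2
    outdeg≤2 v = subst (_≤ 2) (sym (trans (outdeg≡occurrences-tails v) (occurrences-tails v))) (byCase v)
      where
      byCase : ∀ v → occurrencesByPart v ≤ 2
      byCase v with ℕP.<-cmp v P
      ... | tri< v<P _ _ = occurrencesByPart-outside v (inj₁ (ℕP.<-trans v<P (ℕP.n<1+n P))) (ℕP.<⇒≢ v<P)
      ... | tri≈ _ refl _ = occurrencesByPart≤ P
          (childOccurrences≤1 P)
          (occurrences-distinct P {[ P ]} ([] ∷ []))
          (absent (All.map (λ { (1+P≤x , _) → ≢-sym (ℕP.<⇒≢ 1+P≤x) }) spokes-bounds))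
          (absent (All.map (λ { (1+P≤x , _) → ≢-sym (ℕP.<⇒≢ 1+P≤x) }) prefix-bounds))
          (absent (All.map L∌P ws⊆L))
          (absent (≢-sym (ℕP.<⇒≢ (ℕP.n<1+n P)) ∷ []))
      ... | tri> _ _ P<v with ℕP.m≤n⇒m<n∨m≡n P<v
      ... | inj₂ refl = occurrencesByPart≤ (suc P)
          (ℕP.≤-reflexive (childOccurrences-block (∈-block ℕP.≤-refl 1+P≤P+k)))
          (absent (ℕP.<⇒≢ (ℕP.n<1+n P) ∷ []))
          (absent (All.map (λ { (2+P≤x , _) → ≢-sym (ℕP.<⇒≢ 2+P≤x) }) (consecutive-bounds (suc (suc P)) j)))
          (occurrences-distinct (suc P) (AllPairs.map ℕP.<⇒≢ (consecutive-sorted (suc P) m)))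
          (absent (All.map (λ outside → ≢-sym (inBlock≢outside ℕP.≤-refl 1+P≤P+k outside)) ws-outside))
          (occurrences-distinct (suc P) {[ suc P ]} ([] ∷ []))
      ... | inj₁ 1+P<v with v ≤? P + k
      ... | yes v≤P+k = occurrencesByPart≤ v
          (ℕP.≤-reflexive (childOccurrences-block (∈-block (ℕP.<⇒≤ 1+P<v) v≤P+k)))
          (absent (ℕP.<⇒≢ (ℕP.<-trans (ℕP.n<1+n P) 1+P<v) ∷ []))
          (occurrences-distinct v (AllPairs.map ℕP.<⇒≢ (consecutive-sorted (suc (suc P)) j)))
          (occurrences-distinct v (AllPairs.map ℕP.<⇒≢ (consecutive-sorted (suc P) m)))
          (absent (All.map (λ outside → ≢-sym (inBlock≢outside (ℕP.<⇒≤ 1+P<v) v≤P+k outside)) ws-outside))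
          (absent (ℕP.<⇒≢ 1+P<v ∷ []))
      ... | no  v≰P+k = occurrencesByPart-outside v (inj₂ (ℕP.≰⇒> v≰P+k)) (≢-sym (ℕP.<⇒≢ P<v))

    eulerSum-arcs≡core : eulerSum N zeroDemand arcs ≡ eulerSum N zeroDemand core
    eulerSum-arcs≡core = trans (eulerSum-↭ N zeroDemand arcs↭)
                               (eulerSum-dropSinkArcs (map swap otherEdges) core (sinks , later))
      where
      parentsAvoidCore : All (λ e → All (_≢ proj₁ e) coreTails) otherEdges
      parentsAvoidCore = All.zipWith
        (λ { {e} (t≢P , childless) → ≢-sym t≢P ∷ All.map (λ x∈L x≡t → All.lookup childless x∈L (sym x≡t))
               (AllP.++⁺ (All.map (λ { (1+P≤x , x≤P+k) → All.lookup block⊆L (∈-block 1+P≤x x≤P+k) }) spokes-bounds)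
               (AllP.++⁺ (All.map (λ { (1+P≤x , x≤P+k) → All.lookup block⊆L (∈-block 1+P≤x x≤P+k) }) prefix-bounds)
               (AllP.++⁺ ws⊆L (All.lookup block⊆L (∈-block ℕP.≤-refl 1+P≤P+k) ∷ [])))) })
        (AllP.all-filter (λ e → ¬? (proj₁ e ≟ P)) E , AllP.filter⁺ (λ e → ¬? (proj₁ e ≟ P)) leaves-childless)
      sinks : All (λ a → proj₂ a < N × 0ℤ ℤ.≤ 0ℤ × proj₁ a ≢ proj₂ a × All (λ b → proj₁ b ≢ proj₂ a) core)
                  (map swap otherEdges)
      sinks = AllP.map⁺ (All.zipWith
        (λ { ((t<h , h<N) , avoid) → ℕP.<-trans t<h h<N , ℤP.≤-refl , ≢-sym (ℕP.<⇒≢ t<h) ,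
                                     AllP.map⁻ (subst (All (_≢ _)) (sym map-proj₁-core) avoid) })
        (AllP.filter⁺ (λ e → ¬? (proj₁ e ≟ P)) edges-bounded , parentsAvoidCore))
      later : AllPairs (λ a b → proj₁ b ≢ proj₂ a) (map swap otherEdges)
      later = AllPairsP.map⁺ (increasing (All.map proj₁ (AllP.filter⁺ (λ e → ¬? (proj₁ e ≟ P)) edges-bounded))
                                         (AllPairsP.filter⁺ (λ e → ¬? (proj₁ e ≟ P)) (AllPairsP.map⁻ children-sorted)))
        where
        increasing : ∀ {es} → All (λ e → proj₁ e < proj₂ e) es → AllPairs (λ e e′ → proj₂ e < proj₂ e′) es →
                     AllPairs (λ e e′ → proj₂ e′ ≢ proj₁ e) es
        increasing []           []             = []
        increasing (t<h ∷ t<hs) (h<hs ∷ sorted) =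
          All.map (λ h<h′ → ≢-sym (ℕP.<⇒≢ (ℕP.<-trans t<h h<h′))) h<hs ∷ increasing t<hs sorted

    fanRim : List Arc
    fanRim = fanArcs ++ forward

    core↭ : core ↭ path (suc P ∷ reverse ws ++ [ y ]) ++ fanRim
    core↭ = ↭-trans (↭-reflexive (sym (LP.++-assoc fanArcs forward (map swap back))))
            (↭-trans (↭P.++-comm fanRim (map swap back))
                     (↭P.++⁺ʳ fanRim (subst (map swap back ↭_) (cong path reversed) (map-swap-path↭ (y ∷ ws ++ [ suc P ])))))
      where
      reversed : reverse (y ∷ ws ++ [ suc P ]) ≡ suc P ∷ reverse ws ++ [ y ]
      reversed = trans (LP.reverse-++ (y ∷ ws) [ suc P ]) (cong (suc P ∷_) (LP.unfold-reverse y ws))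

    FanVertex : ℕ → Set
    FanVertex x = x ≡ P ⊎ (suc P ≤ x × x ≤ P + k) ⊎ x ≡ y

    fanRim-vertices : All (λ a → FanVertex (proj₁ a) × FanVertex (proj₂ a)) fanRim
    fanRim-vertices = AllP.++⁺
      ((inj₁ refl , inj₂ (inj₁ (ℕP.≤-refl , 1+P≤P+k))) ∷
       AllP.map⁺ (All.map (λ x∈block → inj₂ (inj₁ x∈block) , inj₁ refl) spokes-bounds))
      (All-path (AllP.++⁺ (All.map (inj₂ ∘ inj₁) prefix-bounds) (inj₂ (inj₂ refl) ∷ [])))

    returnPath-interior : All (Interior N zeroDemand fanRim (suc P) y) (reverse ws)
    returnPath-interior = ↭P.All-resp-↭ (↭-sym (↭P.↭-reverse ws)) (All.zipWith
      (λ { {w} ((outside , w∈L) , w≢y) →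
           All.lookup leaves-bounded w∈L , refl ,
           All.map (λ { (vt , vh) → avoid outside w∈L w≢y vt , avoid outside w∈L w≢y vh }) fanRim-vertices ,
           ≢-sym (inBlock≢outside ℕP.≤-refl 1+P≤P+k outside) , w≢y })
      (All.zipWith id (ws-outside , ws⊆L) , ws≢y))
      where
      avoid : ∀ {w x} → OutsideBlock P k w → w ∈ L → w ≢ y → FanVertex x → x ≢ w
      avoid _       w∈L _   (inj₁ refl)                      = ≢-sym (L∌P w∈L)
      avoid outside _   _   (inj₂ (inj₁ (1+P≤x , x≤P+k)))   = inBlock≢outside 1+P≤x x≤P+k outside
      avoid _       _   w≢y (inj₂ (inj₂ refl))               = ≢-sym w≢y

    returnPath-distinct : AllPairs _≢_ (reverse ws)
    returnPath-distinct = ↭ₛP.AllPairs-resp-↭ ≢-sym ((λ { refl x≢y → x≢y }) , (λ { refl x≢y → x≢y }))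
                                              (↭⇒↭ₛ (↭-sym (↭P.↭-reverse ws))) ws-distinct

    eulerSum-arcs : eulerSum N zeroDemand arcs ≡
                    eulerSum N zeroDemand fanRim ℤ.+ -1ℤ ℤ.^ suc (length ws) ℤ.* eulerSum N (zeroDemand ⊕ (suc P , y)) fanRim
    eulerSum-arcs = trans eulerSum-arcs≡core (trans (eulerSum-↭ N zeroDemand core↭)
      (trans (eulerSum-path N zeroDemand fanRim (suc P) y (reverse ws) returnPath-interior returnPath-distinct)
             (cong (λ n → eulerSum N zeroDemand fanRim ℤ.+ -1ℤ ℤ.^ suc n ℤ.* eulerSum N (zeroDemand ⊕ (suc P , y)) fanRim)
                   (LP.length-reverse ws))))

    fan↭zigzag : fanArcs ++ path block ↭ (P , suc P) ∷ zigzag P (suc P) j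
    fan↭zigzag = ↭-prep (P , suc P)
      (subst (λ xs → map (_, P) spokes ++ path xs ↭ zigzag P (suc P) j) (sym block≡∷) (spokes++rim↭zigzag P (suc P) j))

    1+P+j<N : suc P + j < N
    1+P+j<N = subst (_< N) (sym 1+P+j≡P+k) (All.lookup leaves-bounded (All.lookup block⊆L (∈-block 1+P≤P+k ℕP.≤-refl)))

    eulerSum-fanBlock : eulerSum N zeroDemand (fanArcs ++ path block) ≡ 1ℤ ℤ.- parity j
    eulerSum-fanBlock = trans (eulerSum-↭ N zeroDemand fan↭zigzag) (eulerSum-fan N P (suc P) j (ℕP.n<1+n P) 1+P+j<N)

    fanArcs-tailFree : ∀ {x} → x ≢ P → OutsideBlock P k x → All (λ a → proj₁ a ≢ x) fanArcs
    fanArcs-tailFree x≢P outside =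
      ≢-sym x≢P ∷ AllP.map⁺ (All.map (λ { (1+P≤s , s≤P+k) → inBlock≢outside 1+P≤s s≤P+k outside }) spokes-bounds)

    -- k odd: the prefix is the whole block and y is the leaf following it
    eulerSum-arcs-wholeBlock : m ≡ k → parity j ≡ 0ℤ → eulerSum N zeroDemand arcs ≡ 1ℤ
    eulerSum-arcs-wholeBlock m≡k parity≡0 =
      trans eulerSum-arcs (trans (cong₂ (λ p q → p ℤ.+ -1ℤ ℤ.^ suc (length ws) ℤ.* q) withoutChord withChord)
                                 (cong (λ p → 1ℤ ℤ.+ p) (ℤP.*-zeroʳ (-1ℤ ℤ.^ suc (length ws)))))
      where
      y-outsideBlock : OutsideBlock P k y
      y-outsideBlock = subst (λ n → y < suc P ⊎ P + n < y) m≡k y-outside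
      forward≡ : forward ≡ path block ++ [ (P + k , y) ]
      forward≡ = begin
          path (prefix ++ [ y ])
        ≡⟨ cong (λ xs → path (xs ++ [ y ])) (trans (cong (consecutive (suc P)) m≡k) block≡∷ʳ) ⟩
          path ((consecutive (suc P) j ++ [ P + k ]) ++ [ y ])
        ≡⟨ cong path (LP.++-assoc (consecutive (suc P) j) [ P + k ] [ y ]) ⟩
          path (consecutive (suc P) j ++ (P + k) ∷ y ∷ [])
        ≡⟨ path-++ (consecutive (suc P) j) (P + k) [ y ] ⟩
          path (consecutive (suc P) j ++ [ P + k ]) ++ [ (P + k , y) ]
        ≡⟨ cong (λ xs → path xs ++ [ (P + k , y) ]) (sym block≡∷ʳ) ⟩
          path block ++ [ (P + k , y) ]
        ∎
        where open ≡-Reasoning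
      yNotTail : All (λ a → proj₁ a ≢ y) (fanArcs ++ path block)
      yNotTail = AllP.++⁺ (fanArcs-tailFree (L∌P y∈L) y-outsideBlock)
        (All.map (λ { ((1+P≤t , t≤P+k) , _) → inBlock≢outside 1+P≤t t≤P+k y-outsideBlock }) (All-path block-bounds))
      withoutChord : eulerSum N zeroDemand fanRim ≡ 1ℤ
      withoutChord = begin
          eulerSum N zeroDemand fanRim
        ≡⟨ eulerSum-↭ N zeroDemand (subst (λ arcs → fanArcs ++ arcs ↭ (P + k , y) ∷ fanArcs ++ path block) (sym forward≡)
             (↭-trans (↭-reflexive (sym (LP.++-assoc fanArcs (path block) _))) (↭P.++-comm (fanArcs ++ path block) _))) ⟩
          eulerSum N zeroDemand ((P + k , y) ∷ fanArcs ++ path block)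
        ≡⟨ eulerSum-dropArcIntoSink (P + k , y) (fanArcs ++ path block) (All.lookup leaves-bounded y∈L) ℤP.≤-refl
             (inBlock≢outside 1+P≤P+k ℕP.≤-refl y-outsideBlock) yNotTail ⟩
          eulerSum N zeroDemand (fanArcs ++ path block)
        ≡⟨ trans eulerSum-fanBlock (cong (λ p → 1ℤ ℤ.- p) parity≡0) ⟩
          1ℤ
        ∎
        where open ≡-Reasoning
      withChord : eulerSum N (zeroDemand ⊕ (suc P , y)) fanRim ≡ 0ℤ
      withChord = eulerSum-⊕-noExit zeroDemand fanRim (All.lookup leaves-bounded y∈L) refl
        (inBlock≢outside ℕP.≤-refl 1+P≤P+k y-outsideBlock)
        (AllP.++⁺ (fanArcs-tailFree (L∌P y∈L) y-outsideBlock)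
                  (All-proj₁-path y (All.map (λ { (1+P≤t , t≤P+k) → inBlock≢outside 1+P≤t t≤P+k y-outsideBlock })
                                             prefix-bounds)))

    -- k even: the prefix stops one short of the block, whose last leaf is y
    eulerSum-arcs-blockButLast : m ≡ j → y ≡ P + k → parity j ≡ 1ℤ → -1ℤ ℤ.^ suc (length ws) ≡ 1ℤ →
                                 eulerSum N zeroDemand arcs ≡ 1ℤ
    eulerSum-arcs-blockButLast m≡j y≡P+k parity≡1 evenReturn =
      trans eulerSum-arcs (cong₂ (λ p q → p ℤ.+ q) withoutChord
                                  (trans (cong₂ ℤ._*_ evenReturn withChord) refl))
      where
      forward≡ : forward ≡ path block
      forward≡ = cong path (trans (cong₂ (λ n z → consecutive (suc P) n ++ [ z ]) m≡j y≡P+k) (sym block≡∷ʳ))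
      withoutChord : eulerSum N zeroDemand fanRim ≡ 0ℤ
      withoutChord = trans (cong (λ arcs → eulerSum N zeroDemand (fanArcs ++ arcs)) forward≡)
                           (trans eulerSum-fanBlock (cong (λ p → 1ℤ ℤ.- p) parity≡1))
      withChord : eulerSum N (zeroDemand ⊕ (suc P , y)) fanRim ≡ 1ℤ
      withChord = trans (cong (λ arcs → eulerSum N (zeroDemand ⊕ (suc P , y)) (fanArcs ++ arcs)) forward≡)
        (trans (eulerSum-↭ N _ fan↭zigzag)
               (subst (λ i → eulerSum N (zeroDemand ⊕ (suc P , y)) ((P , suc P) ∷ zigzag P (suc P) i) ≡ 1ℤ) (sym j≡1+j′)
                      (eulerSum-fan-chord N P (suc P) j′ y (ℕP.n<1+n P)
                                          (trans y≡P+k (trans (sym 1+P+j≡P+k) (cong (suc P +_) j≡1+j′)))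
                                          (All.lookup leaves-bounded y∈L))))
        where
        j′ : ℕ
        j′ = proj₁ j-1
        j≡1+j′ : j ≡ suc j′
        j≡1+j′ = proj₂ j-1

  module Upper (H : LabelledHalin) where
    open Geometry H

    graph : Graph
    graph = mkGraph N (E ++ cycleEdges L)

    hasATOrientation : (S : CycleSplit) → eulerSum N zeroDemand (Oriented.arcs H S) ≡ 1ℤ → HasATOrientation graph 3
    hasATOrientation S σ≡1 = orientation , (λ v _ → subst (λ bs → outdeg v (orient (E ++ cycleEdges L) bs) < 3) (sym toList≡)
                                                           (s≤s (Oriented.outdeg≤2 H S v)))
                                         , subst (λ bs → AlonTarsi N (orient (E ++ cycleEdges L) bs)) (sym toList≡)
                                                 (eulerSum≡1⇒AlonTarsi N (Oriented.arcs H S) σ≡1)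
      where
      open CycleSplit S using (m)
      orientation : Vec Bool (length (E ++ cycleEdges L))
      orientation = Vec.map (keep P m) (Vec.fromList (E ++ cycleEdges L))
      toList≡ : Vec.toList orientation ≡ map (keep P m) (E ++ cycleEdges L)
      toList≡ = trans (VecP.toList-map (keep P m) _) (cong (map (keep P m)) (VecP.toList∘fromList (E ++ cycleEdges L)))

    rest≡∷ : ∃ λ r → ∃ λ rs → rest ≡ r ∷ rs
    rest≡∷ with rest | 2≤|rest|
    ... | r ∷ rs | _ = r , rs , refl

    splitAfterBlock : CycleSplit
    splitAfterBlock = record
      { m = k ; y = r ; ws = rs ; 1≤m = ℕP.≤-trans (s≤s z≤n) 2≤k ; m≤k = ℕP.≤-refl
      ; splits = cong (block ++_) rest≡
      ; y-outside = All.head outside ; ws-outside = All.tail outside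
      ; ws-distinct = AllPairs.tail distinct ; ws⊆L = All.tail ⊆L ; y∈L = All.head ⊆L
      ; ws≢y = All.map ≢-sym (AllPairs.head distinct) }
      where
      r : ℕ
      r = proj₁ rest≡∷
      rs : List ℕ
      rs = proj₁ (proj₂ rest≡∷)
      rest≡ : rest ≡ r ∷ rs
      rest≡ = proj₂ (proj₂ rest≡∷)
      outside : All (OutsideBlock P k) (r ∷ rs)
      outside = subst (All (OutsideBlock P k)) rest≡ rest-outside
      distinct : AllPairs _≢_ (r ∷ rs)
      distinct = subst (AllPairs _≢_) rest≡ rest-distinct
      ⊆L : All (_∈ L) (r ∷ rs)
      ⊆L = subst (All (_∈ L)) rest≡ rest⊆L

    splitBeforeLast : CycleSplit
    splitBeforeLast = record
      { m = j ; y = P + k ; ws = rest ; 1≤m = 1≤j ; m≤k = ℕP.<⇒≤ j<k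
      ; splits = trans (cong (_++ rest) block≡∷ʳ) (LP.++-assoc (consecutive (suc P) j) [ P + k ] rest)
      ; y-outside = inj₂ (ℕP.+-monoʳ-< P j<k)
      ; ws-outside = rest-outside ; ws-distinct = rest-distinct ; ws⊆L = rest⊆L
      ; y∈L = All.lookup block⊆L (∈-block 1+P≤P+k ℕP.≤-refl)
      ; ws≢y = All.map (λ outside → ≢-sym (inBlock≢outside 1+P≤P+k ℕP.≤-refl outside)) rest-outside }
      where
      j<k : j < k
      j<k = subst (j <_) (sym k≡1+j) (ℕP.n<1+n j)

    -- the return path of splitBeforeLast has an even number of arcs since |L| is odd and k is even
    evenReturn : -1ℤ ℤ.^ k ≡ 1ℤ → -1ℤ ℤ.^ suc (length rest) ≡ 1ℤ
    evenReturn k-even = begin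
        -1ℤ ℤ.* -1ℤ ℤ.^ length (after ++ before)
      ≡⟨ cong (λ n → -1ℤ ℤ.* -1ℤ ℤ.^ n) (trans (LP.length-++ after) (ℕP.+-comm (length after) (length before))) ⟩
        -1ℤ ℤ.* -1ℤ ℤ.^ (length before + length after)
      ≡⟨ cong (-1ℤ ℤ.*_) (sym (trans (cong (λ n → -1ℤ ℤ.^ (length before + n)) (ℕP.+-comm k (length after)))
                               (trans (cong (-1ℤ ℤ.^_) (sym (ℕP.+-assoc (length before) (length after) k)))
                                      (trans (ℤP.^-distribˡ-+-* -1ℤ (length before + length after) k)
                                             (trans (cong ((-1ℤ ℤ.^ (length before + length after)) ℤ.*_) k-even)
                                                    (ℤP.*-identityʳ _)))))) ⟩
        -1ℤ ℤ.* -1ℤ ℤ.^ (length before + (k + length after))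
      ≡⟨ cong (λ n → -1ℤ ℤ.* -1ℤ ℤ.^ n) (sym |L|≡) ⟩
        -1ℤ ℤ.* -1ℤ ℤ.^ length L
      ≡⟨ cong (-1ℤ ℤ.*_) (trans (-1^-isEven (length L)) (cong (λ r → if r ℕ.≡ᵇ 0 then 1ℤ else -1ℤ) odd)) ⟩
        1ℤ
      ∎
      where
      open ≡-Reasoning
      |L|≡ : length L ≡ length before + (k + length after)
      |L|≡ = trans (cong length leaves≡) (trans (LP.length-++ before)
                (cong (length before +_) (trans (LP.length-++ block) (cong (_+ length after) (length-consecutive (suc P) k)))))

    upper : HasATOrientation graph 3
    upper with parity-sign j
    ... | inj₁ (parity≡0 , _) =
      hasATOrientation splitAfterBlock (Oriented.eulerSum-arcs-wholeBlock H splitAfterBlock refl parity≡0)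
    ... | inj₂ (parity≡1 , j-odd) =
      hasATOrientation splitBeforeLast
        (Oriented.eulerSum-arcs-blockButLast H splitBeforeLast refl refl parity≡1
          (evenReturn (trans (cong (-1ℤ ℤ.^_) k≡1+j) (cong (-1ℤ ℤ.*_) j-odd))))

module Theorem where

  open Paths using (consecutive; cycleEdges≡cycle; All-cycle; length-cycle; length-consecutive)
  open Labelling
  open LeafFans
  open HalinFan
  open OutdegreeSum using (moreEdgesThanVertices⇒AT≥3)
  open import Data.Nat as ℕ using (suc; _+_; _<_; _≤_; z≤n; s≤s; _%_)
  import Data.Nat.Properties as ℕP
  open import Data.List using ([]; _∷_; _++_; length)
  import Data.List.Properties as LP
  open import Data.List.Relation.Unary.All as All using (All)
  import Data.List.Relation.Unary.All.Properties as AllP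
  open import Data.Product using (_×_; _,_; proj₁; proj₂)
  open import Relation.Binary.PropositionalEquality

  ATNumber≡3 : (H : LabelledHalin) → ATNumber (Upper.graph H) 3
  ATNumber≡3 H = Upper.upper H , moreEdgesThanVertices⇒AT≥3 (Upper.graph H) bounded N<|edges|
    where
    open LabelledHalin H
    bounded : All (λ e → proj₁ e < N × proj₂ e < N) (E ++ cycleEdges L)
    bounded = AllP.++⁺ (All.map (λ { (t<h , h<N) → ℕP.<-trans t<h h<N , h<N }) edges-bounded)
                       (subst (All _) (sym (cycleEdges≡cycle L)) (All-cycle leaves-bounded))
    2≤|L| : 2 ≤ length L
    2≤|L| = subst (λ xs → 2 ≤ length xs) (sym leaves≡)
      (ℕP.≤-trans 2≤k (ℕP.≤-trans (ℕP.≤-reflexive (sym (length-consecutive (suc P) k)))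
                      (ℕP.≤-trans (LP.length-++-≤ˡ (consecutive (suc P) k)) (LP.length-++-≤ʳ _ {before}))))
    N<|edges| : N < length (E ++ cycleEdges L)
    N<|edges| = subst₂ _<_ (sym size)
      (sym (trans (LP.length-++ E) (cong (length E +_) (trans (cong length (cycleEdges≡cycle L)) (length-cycle L)))))
      (subst (_≤ length E + length L) (ℕP.+-comm (length E) 2) (ℕP.+-monoʳ-≤ (length E) 2≤|L|))

  labelledHalin : ∀ t → HalinTree t → NotWheel t → outerLength t % 2 ≡ 1 → LabelledHalin
  labelledHalin (node [])       (() , _)
  labelledHalin t@(node (c ∷ cs)) (3≤deg , noDeg2) notWheel odd = record
    { N = next (label t 0) ; E = edgesOf (label t 0) ; L = leavesOf (label t 0)
    ; P = P ; k = k ; before = before ; after = after ; 2≤k = 2≤k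
    ; size = trans T.size (cong suc (ℕP.+-identityʳ _))
    ; edges-bounded = All.map (λ { (_ , t<h , h<N) → t<h , h<N }) T.edges-bounded
    ; children-sorted = T.children-sorted
    ; leaves-bounded = All.map proj₂ T.leaves-bounded
    ; leaves-sorted = T.leaves-sorted
    ; leaves-childless = T.leaves-childless
    ; edgesFrom-P = edgesFrom-P ; leaves≡ = leaves≡
    ; 2≤others = ℕP.≤-pred (ℕP.≤-trans 3≤deg others)
    ; odd = odd }
    where
    module T = TreeLabelling (label-correct t 0)
    fan : LeafFanIn 1 (c ∷ cs) (label t 0)
    fan = leafFan-forest (c ∷ cs) 0 1 (s≤s z≤n) noDeg2 notWheel
    open LeafFan (proj₁ fan)
    others : length (c ∷ cs) ≤ suc (length before + length after)
    others = proj₂ fan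

open Theorem using (ATNumber≡3; labelledHalin)

lemma3p6 : (t : Tree) → HalinTree t → NotWheel t → outerLength t % 2 ≡ 1 →
    ATNumber (halin t) 3
lemma3p6 (node [])           (() , _)
lemma3p6 t@(node (_ ∷ _)) halinTree notWheel odd = ATNumber≡3 (labelledHalin t halinTree notWheel odd)
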